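{- Let $G$ be a connected finite graph, $\alpha\in H_1(G,\mathbb Z)$, $\underline\alpha=\alpha+\Lambda\in Q_\Lambda$, and $l\ge1$. Then (a) $\pi_c(\alpha,l)=\sum_{d\mid l}\sum_{\beta\in[\alpha\mid(l/d)]}\pi(\beta,d)$; (b) $\pi_c(\underline\alpha,l)=\sum_{d\mid l}\sum_{\underline\beta\in[\underline\alpha\mid(l/d)]}\pi(\underline\beta,d)$; (c) $N(\alpha,l)=\sum_{d\mid l}d\sum_{\beta\in[\alpha\mid(l/d)]}\pi(\beta,d)$; (d) $N(\underline\alpha,l)=\sum_{d\mid l}d\sum_{\underline\beta\in[\underline\alpha\mid(l/d)]}\pi(\underline\beta,d)$; (e) $\pi(\alpha,l)=\frac1l\sum_{d\mid l}\mu\left(\frac ld\right)\sum_{\beta\in[\alpha\mid(l/d)]}N(\beta,d)$; (f) $\pi(\underline\alpha,l)=\frac1l\sum_{d\mid l}\mu\left(\frac ld\right)\sum_{\underline\beta\in[\underline\alpha\mid(l/d)]}N(\underline\beta,d)$.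
   Context: $G$: connected finite graph (multiple edges, loops allowed) with oriented edges $\mathbf a$ (initial/terminal vertices $\mathbf a(0),\mathbf a(1)$, inverse $\mathbf a^{ -1}$), positively oriented edges $\mathbf e_1,\dots,\mathbf e_m$ with $\mathbf e_i^{ -1}=-\mathbf e_i$. $H_1(G,\mathbb Z)$ = integer combinations of the $\mathbf e_i$ with zero boundary. $\Lambda$ is a subgroup of finite index in $H_1(G,\mathbb Z)$, $Q_\Lambda=H_1(G,\mathbb Z)/\Lambda$. $[\alpha\mid k]=\{\beta\in H_1(G,\mathbb Z):k\beta=\alpha\}$, $[\underline\alpha\mid k]=\{\underline\beta\in Q_\Lambda:k\underline\beta=\underline\alpha\}$; $\mu$ is the Möbius function. Walks are sequences $\mathbf a_1\cdots\mathbf a_N$ with $\mathbf a_{i+1}(0)=\mathbf a_i(1)$, length $N$; a circuit is a closed walk with no backtrack ($\mathbf a_{i+1}=\mathbf a_i^{ -1}$) and no tail ($\mathbf a_N=\mathbf a_1^{ -1}$); prime circuits are those not equal to $D^r$ for a circuit $D$ and $r>1$; cycles (resp. prime cycles) are classes of circuits (resp. prime circuits) modulo change of starting point. $C^{ab}=\sum\mathbf a_i$. $N(\alpha,l)$, $\pi(\alpha,l)$, $\pi_c(\alpha,l)$: numbers of circuits, prime cycles, cycles of length $l$ with abelianization $\alpha$; $N(\underline\alpha,l)$, $\pi(\underline\alpha,l)$, $\pi_c(\underline\alpha,l)$: the same with abelianization in $\underline\alpha$. -}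

module Defs where

open import Data.Bool using (Bool; true; false; not; if_then_else_)
open import Data.Nat as ℕ using (ℕ; zero; suc; _≥_)
open import Data.Nat.Divisibility using (_∣?_)
open import Data.Nat.Primality using (prime?)
open import Data.Integer as ℤ using (ℤ; +_; -_; _-_)
open import Data.Fin using (Fin; _≟_)
open import Data.Vec using (Vec; tabulate; lookup; replicate; zipWith; foldr)
open import Data.List as L using (List; []; _∷_; _++_; length; map; drop; take; concat; upTo)
open import Data.List.Relation.Unary.All using (All)
open import Data.List.Relation.Unary.Any using (Any)
open import Data.List.Relation.Unary.AllPairs using (AllPairs)
open import Data.List.Relation.Unary.Linked using (Linked)
open import Data.Product using (Σ; ∃; _×_; _,_)
open import Data.Empty using (⊥)
open import Relation.Nullary using (¬_; does)
open import Relation.Binary.PropositionalEquality using (_≡_; _≢_)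

-- Finite graphs (multiple edges and loops allowed).
-- Vertices: Fin V.  Positively oriented edges e_1..e_m: Fin E,
-- with initial vertex src and terminal vertex tgt.

record Graph : Set where
  field
    V   : ℕ
    E   : ℕ
    src : Fin E → Fin V
    tgt : Fin E → Fin V

-- integer "vectors" in ℤ^E (the free abelian group on the e_i)
ℤVec : ℕ → Set
ℤVec n = Vec ℤ n

infixl 6 _⊕_ _⊖_
_⊕_ : ∀ {n} → ℤVec n → ℤVec n → ℤVec n
_⊕_ = zipWith ℤ._+_

⊝_ : ∀ {n} → ℤVec n → ℤVec n
⊝ v = Data.Vec.map -_ v

_⊖_ : ∀ {n} → ℤVec n → ℤVec n → ℤVec n
u ⊖ v = u ⊕ (⊝ v)

𝟘 : ∀ {n} → ℤVec n
𝟘 = replicate _ (+ 0)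

infixl 7 _·_
_·_ : ∀ {n} → ℕ → ℤVec n → ℤVec n
k · v = Data.Vec.map (λ x → + k ℤ.* x) v

sumℤ : List ℤ → ℤ
sumℤ = L.foldr ℤ._+_ (+ 0)

sumℤV : ∀ {n} → Vec ℤ n → ℤ
sumℤV = foldr _ ℤ._+_ (+ 0)

sumℕ : List ℕ → ℕ
sumℕ = L.foldr ℕ._+_ 0

-- Then `length xs` is the number of ≈-classes of
-- {x | P x}, and `sum (map f xs)` is the sum of (≈-invariant) f over
-- those classes.

record EnumUpTo {A : Set} (_≈_ : A → A → Set) (P : A → Set) (xs : List A) : Set where
  field
    sound    : All P xs
    distinct : AllPairs (λ x y → ¬ (x ≈ y)) xs
    complete : ∀ x → P x → Any (λ y → x ≈ y) xs

-- Sum over divisors:  Σ_{d ∣ l} f d (l/d)  written as the sum over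
-- pairs (d , k) with 1 ≤ d, k ≤ l and d * k ≡ l.

range1 : ℕ → List ℕ
range1 l = map suc (upTo l)

divSumℕ : ℕ → (ℕ → ℕ → ℕ) → ℕ
divSumℕ l f = sumℕ (concat (map (λ d → map (λ k →
  if does (d ℕ.* k ℕ.≟ l) then f d k else 0) (range1 l)) (range1 l)))

divSumℤ : ℕ → (ℕ → ℕ → ℤ) → ℤ
divSumℤ l f = sumℤ (concat (map (λ d → map (λ k →
  if does (d ℕ.* k ℕ.≟ l) then f d k else + 0) (range1 l)) (range1 l)))

-- Möbius function:  μ(n) = ∏_{p ≤ n, p prime} (0 if p² ∣ n, -1 if p ∣ n, 1 otherwise)
-- i.e. 0 if n is not squarefree, (-1)^(number of prime factors) otherwise.

μ : ℕ → ℤ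
μ n = go n
  where
  factor : ℕ → ℤ
  factor p = if does (prime? p)
             then (if does ((p ℕ.* p) ∣? n) then + 0
                   else if does (p ∣? n) then ℤ.-[1+ 0 ] else + 1)
             else + 1
  go : ℕ → ℤ
  go zero    = + 1
  go (suc p) = factor (suc p) ℤ.* go p

module _ (G : Graph) where
  open Graph G

  -- oriented edges: (e , true) = e, (e , false) = e⁻¹ = -e
  OEdge : Set
  OEdge = Fin E × Bool

  inv : OEdge → OEdge
  inv (e , b) = e , not b

  start : OEdge → Fin V
  start (e , true)  = src e
  start (e , false) = tgt e

  end : OEdge → Fin V
  end (e , true)  = tgt e
  end (e , false) = src e

  lastOf : OEdge → List OEdge → OEdge
  lastOf a []       = a
  lastOf a (b ∷ bs) = lastOf b bs

  Composable : OEdge → OEdge → Set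
  Composable a b = end a ≡ start b

  WalkFromTo : Fin V → Fin V → List OEdge → Set
  WalkFromTo u v []       = u ≡ v
  WalkFromTo u v (a ∷ as) =
    start a ≡ u × Linked Composable (a ∷ as) × end (lastOf a as) ≡ v

  Connected : Set
  Connected = ∀ u v → ∃ λ w → WalkFromTo u v w

  NoBacktrack : OEdge → OEdge → Set
  NoBacktrack a b = b ≢ inv a

  IsCircuit : List OEdge → Set
  IsCircuit []       = ⊥
  IsCircuit (a ∷ as) =
    Linked Composable (a ∷ as) ×
    end (lastOf a as) ≡ start a ×
    Linked NoBacktrack (a ∷ as) ×
    lastOf a as ≢ inv a

  power : List OEdge → ℕ → List OEdge
  power D r = concat (L.replicate r D)

  IsPrimeCircuit : List OEdge → Set
  IsPrimeCircuit C =
    IsCircuit C × ¬ (Σ (List OEdge) λ D → Σ ℕ λ r → IsCircuit D × r ℕ.> 1 × C ≡ power D r)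

  Rot : List OEdge → List OEdge → Set
  Rot C D = Σ ℕ λ k → D ≡ drop k C ++ take k C

  coeff : Fin E → OEdge → ℤ
  coeff i (e , b) = if does (e ≟ i) then (if b then + 1 else ℤ.-[1+ 0 ]) else + 0

  ab : List OEdge → ℤVec E
  ab C = tabulate (λ i → sumℤ (map (coeff i) C))

  δ : Fin V → Fin V → ℤ
  δ u v = if does (u ≟ v) then + 1 else + 0

  ∂ : ℤVec E → Fin V → ℤ
  ∂ α v = sumℤV (tabulate (λ i → lookup α i ℤ.* (δ (tgt i) v - δ (src i) v)))

  InH₁ : ℤVec E → Set
  InH₁ α = ∀ v → ∂ α v ≡ + 0

  record FiniteIndexSubgroup (Λ : ℤVec E → Set) : Set₁ where
    field
      ⊆H₁     : ∀ α → Λ α → InH₁ α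
      has-0   : Λ 𝟘
      closed+ : ∀ α β → Λ α → Λ β → Λ (α ⊕ β)
      closed- : ∀ α → Λ α → Λ (⊝ α)
      reps    : List (ℤVec E)
      reps-H₁ : All InH₁ reps
      cover   : ∀ α → InH₁ α → Any (λ r → Λ (α ⊖ r)) reps

  infix 4 _≡[_]_
  _≡[_]_ : ℤVec E → (ℤVec E → Set) → ℤVec E → Set
  α ≡[ Λ ] β = Λ (α ⊖ β)

  CircuitWith : ℤVec E → ℕ → List OEdge → Set
  CircuitWith α l C = IsCircuit C × length C ≡ l × ab C ≡ α

  PrimeCircuitWith : ℤVec E → ℕ → List OEdge → Set
  PrimeCircuitWith α l C = IsPrimeCircuit C × length C ≡ l × ab C ≡ α

  CircuitWithQ : (ℤVec E → Set) → ℤVec E → ℕ → List OEdge → Set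
  CircuitWithQ Λ α l C = IsCircuit C × length C ≡ l × ab C ≡[ Λ ] α

  PrimeCircuitWithQ : (ℤVec E → Set) → ℤVec E → ℕ → List OEdge → Set
  PrimeCircuitWithQ Λ α l C = IsPrimeCircuit C × length C ≡ l × ab C ≡[ Λ ] α

  -- [α | k] ⊆ H_1   and   [α̲ | k] ⊆ Q_Λ (represented by elements of H_1)
  DivH : ℤVec E → ℕ → ℤVec E → Set
  DivH α k β = InH₁ β × k · β ≡ α

  DivQ : (ℤVec E → Set) → ℤVec E → ℕ → ℤVec E → Set
  DivQ Λ α k β = InH₁ β × k · β ≡[ Λ ] α

Count : {A : Set} → (A → A → Set) → (A → Set) → ℕ → Set
Count {A} _≈_ P n = Σ (List A) λ xs → EnumUpTo _≈_ P xs × length xs ≡ n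

module Submission where

-- Every circuit C is uniquely D^k with D a prime circuit, its cycle is determined by the
-- cycle of D, and a prime circuit of length d has exactly d distinct rotations: words are
-- compared through their periodic extensions, and by the gcd argument every period of the
-- extension of a primitive word is a multiple of its length. Sorting the circuits of length
-- l with abelianization in [α ∣ K] by the length d and the class β ∈ [α ∣ K k] of their
-- prime root counts them, up to rotation or exactly, by divisor sums of π(β, d); K = 1
-- gives (a)–(d). For general K the same count is Σ_{β ∈ [α ∣ K]} N(β, l), and Möbius
-- inversion of the resulting double divisor sum gives (e) and (f). H₁ and Q_Λ are treated
-- alike, as quotients of ℤ^E in which the k-th roots of α lie in H₁.

module CyclicWord where

  open import Data.Empty using (⊥; ⊥-elim)
  open import Data.List using (List; []; _∷_; _++_; length; drop; take; concat; replicate; upTo)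
  open import Data.List.Properties
    using (length-++; length-take; length-drop; take++drop≡id; take-all; drop-all; drop-[]; take-[]; ++-identityʳ; ++-assoc; ≡-dec)
  open import Data.List.Relation.Unary.Linked using (Linked; []; [-]; _∷_)
  open import Data.List.Relation.Unary.Any as Any using (any?; satisfied)
  open import Data.List.Membership.Propositional.Properties using (∈-upTo⁺)
  open import Data.Maybe using (Maybe; just; nothing)
  open import Data.Nat
  open import Data.Nat.Properties
  open import Data.Nat.DivMod
  open import Data.Nat.Divisibility
  open import Data.Nat.GCD using (module Bézout; module GCD)
  open import Data.Nat.Induction using (<-wellFounded)
  open import Data.Nat.Solver using (module +-*-Solver)
  open import Data.Product using (∃; ∃₂; _×_; _,_; proj₁)
  open import Function using (_∘_; _⇔_; mk⇔)
  open import Induction.WellFounded using (Acc; acc)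
  open import Relation.Binary.Definitions using (DecidableEquality; tri<; tri≈; tri>)
  open import Relation.Binary.PropositionalEquality
  open import Relation.Binary.Structures using (IsEquivalence)
  open import Relation.Nullary using (¬_; Dec; yes; no; _×-dec_)

  open ≡-Reasoning

  private variable
    A B : Set

  nth : List A → ℕ → Maybe A
  nth []       _       = nothing
  nth (x ∷ _)  zero    = just x
  nth (_ ∷ xs) (suc i) = nth xs i

  nth-ext : ∀ (xs ys : List A) → (∀ i → nth xs i ≡ nth ys i) → xs ≡ ys
  nth-ext []       []       _ = refl
  nth-ext []       (_ ∷ _)  h with () ← h 0
  nth-ext (_ ∷ _)  []       h with () ← h 0
  nth-ext (x ∷ xs) (y ∷ ys) h with refl ← h 0 = cong (x ∷_) (nth-ext xs ys (h ∘ suc))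

  nth-≥ : ∀ (xs : List A) {i} → length xs ≤ i → nth xs i ≡ nothing
  nth-≥ []       _        = refl
  nth-≥ (_ ∷ xs) (s≤s le) = nth-≥ xs le

  nth-++ˡ : ∀ (xs ys : List A) {i} → i < length xs → nth (xs ++ ys) i ≡ nth xs i
  nth-++ˡ (_ ∷ _)  ys {zero}  _       = refl
  nth-++ˡ (_ ∷ xs) ys {suc _} (s≤s p) = nth-++ˡ xs ys p

  nth-++ʳ : ∀ (xs ys : List A) j → nth (xs ++ ys) (length xs + j) ≡ nth ys j
  nth-++ʳ []       ys j = refl
  nth-++ʳ (_ ∷ xs) ys j = nth-++ʳ xs ys j

  nth-drop : ∀ k (xs : List A) i → nth (drop k xs) i ≡ nth xs (k + i)
  nth-drop zero    xs       i = refl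
  nth-drop (suc k) []       i = refl
  nth-drop (suc k) (_ ∷ xs) i = nth-drop k xs i

  nth-take : ∀ k (xs : List A) {i} → i < k → nth (take k xs) i ≡ nth xs i
  nth-take (suc k) []       _       = refl
  nth-take (suc k) (_ ∷ _)  {zero}  _       = refl
  nth-take (suc k) (_ ∷ xs) {suc _} (s≤s p) = nth-take k xs p

  take-length-++ : ∀ (xs ys : List A) → take (length xs) (xs ++ ys) ≡ xs
  take-length-++ []       ys = refl
  take-length-++ (x ∷ xs) ys = cong (x ∷_) (take-length-++ xs ys)

  Periodic : (ℕ → B) → ℕ → Set
  Periodic f p = ∀ i → f (i + p) ≡ f i

  module _ {f : ℕ → B} {p : ℕ} (per : Periodic f p) where

    periodic-* : ∀ k → Periodic f (k * p)
    periodic-* zero    i = cong f (+-identityʳ i)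
    periodic-* (suc k) i = begin
      f (i + (p + k * p)) ≡⟨ cong f (+-assoc i p (k * p)) ⟨
      f (i + p + k * p)   ≡⟨ periodic-* k (i + p) ⟩
      f (i + p)           ≡⟨ per i ⟩
      f i                 ∎

    periodic-% : .{{_ : NonZero p}} → ∀ i → f (i % p) ≡ f i
    periodic-% i = begin
      f (i % p)                 ≡⟨ periodic-* (i / p) (i % p) ⟨
      f (i % p + (i / p) * p)   ≡⟨ cong f (m≡m%n+[m/n]*n i p) ⟨
      f i                       ∎

    periodic-shift : ∀ s → Periodic (λ i → f (i + s)) p
    periodic-shift s i = begin
      f (i + p + s) ≡⟨ cong f (trans (+-assoc i p s) (trans (cong (i +_) (+-comm p s)) (sym (+-assoc i s p)))) ⟩
      f (i + s + p) ≡⟨ per (i + s) ⟩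
      f (i + s)     ∎

    -- i = i % p + (i / p) * p and suc i = suc (i % p) + (i / p) * p.
    periodic-step : .{{_ : NonZero p}} → (R : B → B → Set) →
                    (∀ {j} → j < p → R (f j) (f (suc j))) → ∀ i → R (f i) (f (suc i))
    periodic-step R within i =
      subst (λ n → R (f n) (f (suc n))) (sym (m≡m%n+[m/n]*n i p))
        (subst₂ R (sym (periodic-* (i / p) (i % p))) (sym (periodic-* (i / p) (suc (i % p))))
          (within (m%n<n i p)))

  periodic-≗ : ∀ {f g : ℕ → B} {p} → (∀ i → f i ≡ g i) → Periodic f p → Periodic g p
  periodic-≗ f≗g per i = trans (sym (f≗g _)) (trans (per i) (f≗g i))

  periodic-combination : ∀ {f : ℕ → B} {p q d} x y → Periodic f p → Periodic f q →
                         d + y * q ≡ x * p → Periodic f d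
  periodic-combination {f = f} {p} {q} {d} x y perp perq eq i = begin
    f (i + d)         ≡⟨ periodic-* perq y (i + d) ⟨
    f (i + d + y * q) ≡⟨ cong f (trans (+-assoc i d (y * q)) (cong (i +_) eq)) ⟩
    f (i + x * p)     ≡⟨ periodic-* perp x i ⟩
    f i               ∎

  periodic-gcd : ∀ {f : ℕ → B} {p q d} → Periodic f p → Periodic f q → Bézout.Identity d p q → Periodic f d
  periodic-gcd perp perq (Bézout.+- x y eq) = periodic-combination x y perp perq eq
  periodic-gcd perp perq (Bézout.-+ x y eq) = periodic-combination y x perq perp eq

  periodic-difference : ∀ {f : ℕ → B} {L i j} → Periodic f L → i ≤ L → i ≤ j →
                        (∀ n → f (n + i) ≡ f (n + j)) → Periodic f (j ∸ i)
  periodic-difference {f = f} {L} {i} {j} per i≤L i≤j h m = begin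
    f (m + e)           ≡⟨ per (m + e) ⟨
    f (m + e + L)       ≡⟨ cong f rearrange ⟩
    f (m + (L ∸ i) + j) ≡⟨ h (m + (L ∸ i)) ⟨
    f (m + (L ∸ i) + i) ≡⟨ cong f (trans (+-assoc m (L ∸ i) i) (cong (m +_) (m∸n+n≡m i≤L))) ⟩
    f (m + L)           ≡⟨ per m ⟩
    f m                 ∎
    where
    open +-*-Solver
    e = j ∸ i
    rearrange : m + e + L ≡ m + (L ∸ i) + j
    rearrange = begin
      m + e + L                 ≡⟨ cong (m + e +_) (m∸n+n≡m i≤L) ⟨
      m + e + (L ∸ i + i)       ≡⟨ solve 4 (λ m e a i → m :+ e :+ (a :+ i) := m :+ a :+ (i :+ e)) refl m e (L ∸ i) i ⟩
      m + (L ∸ i) + (i + e)     ≡⟨ cong (m + (L ∸ i) +_) (m+[n∸m]≡n i≤j) ⟩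
      m + (L ∸ i) + j           ∎

  cyclic : List A → ℕ → Maybe A
  cyclic []         _ = nothing
  cyclic xs@(_ ∷ _) i = nth xs (i % length xs)

  cyclic-periodic : ∀ (xs : List A) → Periodic (cyclic xs) (length xs)
  cyclic-periodic []         i = refl
  cyclic-periodic xs@(_ ∷ _) i = cong (nth xs) ([m+n]%n≡m%n i (length xs))

  cyclic-< : ∀ (xs : List A) {i} → i < length xs → cyclic xs i ≡ nth xs i
  cyclic-< xs@(_ ∷ _) lt = cong (nth xs) (m<n⇒m%n≡m lt)

  cyclic-ext : ∀ (xs ys : List A) → length xs ≡ length ys → (∀ i → cyclic xs i ≡ cyclic ys i) → xs ≡ ys
  cyclic-ext xs ys len h = nth-ext xs ys nth-eq
    where
    nth-eq : ∀ i → nth xs i ≡ nth ys i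
    nth-eq i with i <? length xs
    ... | yes i< = trans (sym (cyclic-< xs i<)) (trans (h i) (cyclic-< ys (subst (i <_) len i<)))
    ... | no  i≮ = trans (nth-≥ xs (≮⇒≥ i≮)) (sym (nth-≥ ys (subst (_≤ i) len (≮⇒≥ i≮))))

  cyclic-unique : ∀ (xs : List A) {f : ℕ → Maybe A} → 0 < length xs → Periodic f (length xs) →
                  (∀ {j} → j < length xs → nth xs j ≡ f j) → ∀ i → cyclic xs i ≡ f i
  cyclic-unique xs@(_ ∷ _) _ per agree i = trans (agree (m%n<n i (length xs))) (periodic-% per i)

  pow : List A → ℕ → List A
  pow D r = concat (replicate r D)

  length-pow : ∀ (D : List A) r → length (pow D r) ≡ r * length D
  length-pow D zero    = refl
  length-pow D (suc r) = trans (length-++ D) (cong (length D +_) (length-pow D r))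

  pow-+ : ∀ (D : List A) a b → pow D (a + b) ≡ pow D a ++ pow D b
  pow-+ D zero    b = refl
  pow-+ D (suc a) b = trans (cong (D ++_) (pow-+ D a b)) (sym (++-assoc D (pow D a) (pow D b)))

  pow-pow : ∀ (D : List A) a b → pow (pow D a) b ≡ pow D (b * a)
  pow-pow D a zero    = refl
  pow-pow D a (suc b) = trans (cong (pow D a ++_) (pow-pow D a b)) (sym (pow-+ D a (b * a)))

  nth-pow : ∀ (D : List A) k {i} → i < suc k * length D → nth (pow D (suc k)) i ≡ cyclic D i
  nth-pow D k {i} lt with i <? length D
  ... | yes i<D = trans (nth-++ˡ D (pow D k) i<D) (sym (cyclic-< D i<D))
  nth-pow D zero    {i} lt | no i≮D = ⊥-elim (i≮D (subst (i <_) (+-identityʳ (length D)) lt))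
  nth-pow D (suc k) {i} lt | no i≮D = begin
    nth (D ++ pow D (suc k)) i                           ≡⟨ cong (nth (D ++ pow D (suc k))) (m+[n∸m]≡n D≤i) ⟨
    nth (D ++ pow D (suc k)) (length D + (i ∸ length D)) ≡⟨ nth-++ʳ D _ (i ∸ length D) ⟩
    nth (pow D (suc k)) (i ∸ length D)                   ≡⟨ nth-pow D k below ⟩
    cyclic D (i ∸ length D)                              ≡⟨ cyclic-periodic D _ ⟨
    cyclic D (i ∸ length D + length D)                   ≡⟨ cong (cyclic D) (m∸n+n≡m D≤i) ⟩
    cyclic D i                                           ∎
    where
    D≤i = ≮⇒≥ i≮D
    below : i ∸ length D < suc k * length D
    below = subst (i ∸ length D <_) (m+n∸m≡n (length D) _) (∸-monoˡ-< lt D≤i)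

  cyclic-pow : ∀ (D : List A) k i → cyclic (pow D (suc k)) i ≡ cyclic D i
  cyclic-pow []          zero    i = refl
  cyclic-pow []          (suc k) i = cyclic-pow [] k i
  cyclic-pow D@(_ ∷ _)   k       i =
    cyclic-unique (pow D (suc k)) (subst (0 <_) (sym len) z<s)
      (subst (Periodic (cyclic D)) (sym len) (periodic-* (cyclic-periodic D) (suc k)))
      (λ {j} j< → nth-pow D k (subst (j <_) len j<)) i
    where len = length-pow D (suc k)

  rot : ℕ → List A → List A
  rot k xs = drop k xs ++ take k xs

  length-rot : ∀ k (xs : List A) → length (rot k xs) ≡ length xs
  length-rot k xs = begin
    length (drop k xs ++ take k xs)          ≡⟨ length-++ (drop k xs) ⟩
    length (drop k xs) + length (take k xs)  ≡⟨ +-comm (length (drop k xs)) _ ⟩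
    length (take k xs) + length (drop k xs)  ≡⟨ length-++ (take k xs) ⟨
    length (take k xs ++ drop k xs)          ≡⟨ cong length (take++drop≡id k xs) ⟩
    length xs                                ∎

  rot-≥ : ∀ k (xs : List A) → length xs ≤ k → rot k xs ≡ xs
  rot-≥ k xs le rewrite drop-all k xs le | take-all k xs le = refl

  nth-rot : ∀ k (xs : List A) → k ≤ length xs → ∀ {j} → j < length xs → nth (rot k xs) j ≡ cyclic xs (j + k)
  nth-rot k xs k≤ {j} j< with j <? length xs ∸ k
  ... | yes j<L∸k = begin
    nth (drop k xs ++ take k xs) j ≡⟨ nth-++ˡ (drop k xs) (take k xs) (subst (j <_) (sym (length-drop k xs)) j<L∸k) ⟩
    nth (drop k xs) j              ≡⟨ nth-drop k xs j ⟩
    nth xs (k + j)                 ≡⟨ cong (nth xs) (+-comm k j) ⟩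
    nth xs (j + k)                 ≡⟨ cyclic-< xs (subst (j + k <_) (m∸n+n≡m k≤) (+-monoˡ-< k j<L∸k)) ⟨
    cyclic xs (j + k)              ∎
  ... | no j≮L∸k = begin
    nth (drop k xs ++ take k xs) j                        ≡⟨ cong (nth (drop k xs ++ take k xs)) j≡ ⟨
    nth (drop k xs ++ take k xs) (length (drop k xs) + j′) ≡⟨ nth-++ʳ (drop k xs) (take k xs) j′ ⟩
    nth (take k xs) j′                                    ≡⟨ nth-take k xs j′<k ⟩
    nth xs j′                                             ≡⟨ cyclic-< xs (≤-trans j′<k k≤) ⟨
    cyclic xs j′                                          ≡⟨ cyclic-periodic xs j′ ⟨
    cyclic xs (j′ + L)                                    ≡⟨ cong (cyclic xs) j′+L ⟩
    cyclic xs (j + k)                                     ∎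
    where
    L = length xs
    j′ = j ∸ (L ∸ k)
    split : L ∸ k + j′ ≡ j
    split = m+[n∸m]≡n (≮⇒≥ j≮L∸k)
    j≡ : length (drop k xs) + j′ ≡ j
    j≡ = trans (cong (_+ j′) (length-drop k xs)) split
    j′<k : j′ < k
    j′<k = +-cancelˡ-< (L ∸ k) j′ k (subst₂ _<_ (sym split) (sym (m∸n+n≡m k≤)) j<)
    j′+L : j′ + L ≡ j + k
    j′+L = begin
      j′ + L           ≡⟨ cong (j′ +_) (m∸n+n≡m k≤) ⟨
      j′ + (L ∸ k + k) ≡⟨ +-assoc j′ (L ∸ k) k ⟨
      j′ + (L ∸ k) + k ≡⟨ cong (_+ k) (trans (+-comm j′ (L ∸ k)) split) ⟩
      j + k            ∎

  cyclic-rot : ∀ k (xs : List A) → k ≤ length xs → ∀ i → cyclic (rot k xs) i ≡ cyclic xs (i + k)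
  cyclic-rot .0 []         z≤n i = refl
  cyclic-rot k  xs@(_ ∷ _) k≤  =
    cyclic-unique (rot k xs) (subst (0 <_) (sym len) z<s)
      (subst (Periodic (λ i → cyclic xs (i + k))) (sym len) (periodic-shift (cyclic-periodic xs) k))
      (λ {j} j< → nth-rot k xs k≤ (subst (j <_) len j<))
    where len = length-rot k xs

  record Shift (s : ℕ) (C D : List A) : Set where
    constructor shift
    field at : ∀ i → cyclic D i ≡ cyclic C (i + s)

  open Shift

  shift-periodic : ∀ {C D : List A} {s p} → Shift s C D → Periodic (cyclic C) p → Periodic (cyclic D) p
  shift-periodic {s = s} sh per = periodic-≗ (sym ∘ at sh) (periodic-shift per s)

  shift-sym : ∀ {C D : List A} {s} → .{{_ : NonZero (length C)}} → Shift s C D → Shift (s * length C ∸ s) D C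
  shift-sym {C = C} {D} {s} sh = shift λ i → sym (begin
    cyclic D (i + t)            ≡⟨ at sh (i + t) ⟩
    cyclic C (i + t + s)        ≡⟨ cong (cyclic C) (trans (+-assoc i t s) (cong (i +_) (m∸n+n≡m (m≤m*n s (length C))))) ⟩
    cyclic C (i + s * length C) ≡⟨ periodic-* (cyclic-periodic C) s i ⟩
    cyclic C i                  ∎)
    where t = s * length C ∸ s

  shift-trans : ∀ {C D E : List A} {s t} → Shift s C D → Shift t D E → Shift (t + s) C E
  shift-trans {C = C} {s = s} {t} sh₁ sh₂ = shift λ i → trans (at sh₂ i) (trans (at sh₁ (i + t)) (cong (cyclic C) (+-assoc i t s)))

  shift-pow : ∀ (C : List A) k → Shift 0 C (pow C (suc k))
  shift-pow C k = shift λ i → trans (cyclic-pow C k i) (cong (cyclic C) (sym (+-identityʳ i)))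

  shift-pow⁻ : ∀ (C : List A) k → Shift 0 (pow C (suc k)) C
  shift-pow⁻ C k = shift λ i → trans (cong (cyclic C) (sym (+-identityʳ i))) (sym (cyclic-pow C k (i + 0)))

  Rotation : List A → List A → Set
  Rotation C D = ∃ λ k → D ≡ rot k C

  rotation⇒shift : ∀ {C D : List A} → Rotation C D → length D ≡ length C × ∃ λ s → Shift s C D
  rotation⇒shift {C = C} (k , refl) with k ≤? length C
  ... | yes k≤ = length-rot k C , k , shift (cyclic-rot k C k≤)
  ... | no  k≰ = cong length C≡ , 0 , shift λ i → trans (cong (λ w → cyclic w i) C≡) (cong (cyclic C) (sym (+-identityʳ i)))
    where C≡ = rot-≥ k C (<⇒≤ (≰⇒> k≰))

  shift⇒rot% : ∀ {C D : List A} {s} → .{{_ : NonZero (length C)}} → length D ≡ length C → Shift s C D →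
               D ≡ rot (s % length C) C
  shift⇒rot% {C = C} {D} {s} len sh = cyclic-ext D (rot r C) (trans len (sym (length-rot r C))) λ i → begin
    cyclic D i                    ≡⟨ at sh i ⟩
    cyclic C (i + s)              ≡⟨ cong (λ n → cyclic C (i + n)) (m≡m%n+[m/n]*n s L) ⟩
    cyclic C (i + (r + s / L * L)) ≡⟨ cong (cyclic C) (+-assoc i r _) ⟨
    cyclic C (i + r + s / L * L)   ≡⟨ periodic-* (cyclic-periodic C) (s / L) (i + r) ⟩
    cyclic C (i + r)              ≡⟨ cyclic-rot r C (m%n≤n s L) i ⟨
    cyclic (rot r C) i            ∎
    where
    L = length C
    r = s % L

  shift⇒rotation : ∀ {C D : List A} {s} → length D ≡ length C → Shift s C D → Rotation C D
  shift⇒rotation {C = []}      {D = []} _ _ = 0 , refl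
  shift⇒rotation {C = C@(_ ∷ _)} {D} {s} len sh = s % length C , shift⇒rot% {C = C} {D} {s} len sh

  rotation-index : ∀ {C D : List A} → .{{_ : NonZero (length C)}} → Rotation C D → ∃ λ k → k < length C × D ≡ rot k C
  rotation-index {C = C} {D} r with rotation⇒shift r
  ... | len , s , sh = s % length C , m%n<n s (length C) , shift⇒rot% {C = C} {D} {s} len sh

  rotation-refl : ∀ {C : List A} → Rotation C C
  rotation-refl {C = C} = 0 , sym (++-identityʳ C)

  rotation-sym : ∀ {C D : List A} → Rotation C D → Rotation D C
  rotation-sym {C = []} (k , refl) = 0 , sym (trans (++-identityʳ (rot k [])) (cong₂ _++_ (drop-[] k) (take-[] k)))
  rotation-sym {C = C@(_ ∷ _)} {D} r with rotation⇒shift r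
  ... | len , s , sh = shift⇒rotation {C = D} {C} (sym len) (shift-sym {C = C} {D} {s} sh)

  rotation-trans : ∀ {C D E : List A} → Rotation C D → Rotation D E → Rotation C E
  rotation-trans r₁ r₂ with rotation⇒shift r₁ | rotation⇒shift r₂
  ... | len₁ , s , sh₁ | len₂ , t , sh₂ = shift⇒rotation (trans len₂ len₁) (shift-trans sh₁ sh₂)

  ≡⇒rotation : ∀ {C D : List A} → C ≡ D → Rotation C D
  ≡⇒rotation refl = rotation-refl

  rotation-isEquivalence : IsEquivalence (Rotation {A = A})
  rotation-isEquivalence = record { refl = rotation-refl ; sym = rotation-sym ; trans = rotation-trans }

  rotation-pow : ∀ {C D : List A} k → Rotation C D → Rotation (pow C (suc k)) (pow D (suc k))
  rotation-pow {C = C} {D} k r with rotation⇒shift r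
  ... | len , s , sh = shift⇒rotation len′ (shift λ i → trans (cyclic-pow D k i) (trans (at sh i) (sym (cyclic-pow C k (i + s)))))
    where
    len′ = trans (length-pow D (suc k)) (trans (cong (suc k *_) len) (sym (length-pow C (suc k))))

  record Primitive (C : List A) : Set where
    constructor mkPrimitive
    field length∣period : ∀ p → Periodic (cyclic C) (suc p) → length C ∣ suc p

  open Primitive

  primitive⇒nonempty : ∀ {C : List A} → Primitive C → 0 < length C
  primitive⇒nonempty {C = []}    pr with () ← 0∣⇒≡0 (length∣period pr 0 (λ _ → refl))
  primitive⇒nonempty {C = _ ∷ _} _  = z<s

  primitive-shift-length : ∀ {C D : List A} {s} → Primitive C → Primitive D → Shift s C D → length D ≡ length C
  primitive-shift-length {C = []}           pC _ _ with () ← primitive⇒nonempty pC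
  primitive-shift-length {C = _ ∷ _} {[]}   _ pD _ with () ← primitive⇒nonempty pD
  primitive-shift-length {C = C@(_ ∷ _)} {D@(_ ∷ _)} pC pD sh = ∣-antisym
    (length∣period pD _ (shift-periodic sh (cyclic-periodic C)))
    (length∣period pC _ (shift-periodic (shift-sym sh) (cyclic-periodic D)))

  primitive-rotation : ∀ {C D : List A} → Primitive C → Rotation C D → Primitive D
  primitive-rotation {C = []} pC _ with () ← primitive⇒nonempty pC
  primitive-rotation {C = _ ∷ _} pC r with rotation⇒shift r
  ... | len , s , sh = mkPrimitive λ p per →
    subst (_∣ suc p) (sym len) (length∣period pC p (shift-periodic (shift-sym sh) per))

  rotation-pow⁻ : ∀ {C D : List A} k k′ → Primitive C → Primitive D →
                  Rotation (pow C (suc k)) (pow D (suc k′)) → Rotation C D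
  rotation-pow⁻ {C = C} {D} k k′ pC pD r with rotation⇒shift r
  ... | _ , s , sh = shift⇒rotation (primitive-shift-length pC pD sh′) sh′
    where
    sh′ : Shift s C D
    sh′ = shift λ i → trans (sym (cyclic-pow D k′ i)) (trans (at sh i) (cyclic-pow C k (i + s)))

  pow-injective : ∀ {C D : List A} k k′ → Primitive C → Primitive D → pow C (suc k) ≡ pow D (suc k′) → C ≡ D
  pow-injective {C = C} {D} k k′ pC pD eq =
    cyclic-ext C D (sym (primitive-shift-length pC pD sh)) (λ i → sym (trans (at sh i) (cong (cyclic C) (+-identityʳ i))))
    where
    sh : Shift 0 C D
    sh = shift-trans (shift-pow C k) (subst (λ w → Shift 0 w D) (sym eq) (shift-pow⁻ D k′))

  primitive-no-short-period : ∀ {D : List A} {e} → Primitive D → 0 < e → e < length D → ¬ Periodic (cyclic D) e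
  primitive-no-short-period {e = suc e} pD _ e< per = <⇒≱ e< (∣⇒≤ (length∣period pD e per))

  rot-≢ : ∀ {D : List A} {i j} → Primitive D → i < j → j < length D → rot i D ≢ rot j D
  rot-≢ {D = D} {i} {j} pD i<j j< eq =
    primitive-no-short-period pD (m<n⇒0<n∸m i<j) (≤-<-trans (m∸n≤m j i) j<)
      (periodic-difference (cyclic-periodic D) (<⇒≤ i<D) (<⇒≤ i<j) same-shift)
    where
    i<D = <-trans i<j j<
    same-shift : ∀ n → cyclic D (n + i) ≡ cyclic D (n + j)
    same-shift n = begin
      cyclic D (n + i)   ≡⟨ cyclic-rot i D (<⇒≤ i<D) n ⟨
      cyclic (rot i D) n ≡⟨ cong (λ w → cyclic w n) eq ⟩
      cyclic (rot j D) n ≡⟨ cyclic-rot j D (<⇒≤ j<) n ⟩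
      cyclic D (n + j)   ∎

  rot-injective : ∀ {D : List A} {i j} → Primitive D → i < length D → j < length D → rot i D ≡ rot j D → i ≡ j
  rot-injective pD i< j< eq with <-cmp _ _
  ... | tri< i<j _ _ = ⊥-elim (rot-≢ pD i<j j< eq)
  ... | tri≈ _ i≡j _ = i≡j
  ... | tri> _ _ j<i = ⊥-elim (rot-≢ pD j<i i< (sym eq))

  Related : (A → A → Set) → Maybe A → Maybe A → Set
  Related R (just a) (just b) = R a b
  Related R _        _        = ⊥

  record CyclicallyLinked (R : A → A → Set) (xs : List A) : Set where
    constructor cyclicallyLinked
    field step : ∀ i → Related R (cyclic xs i) (cyclic xs (suc i))

  open CyclicallyLinked

  module _ {R : A → A → Set} where

    cyclicallyLinked⇒nonempty : ∀ {xs} → CyclicallyLinked R xs → 0 < length xs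
    cyclicallyLinked⇒nonempty {[]}    cl = ⊥-elim (step cl 0)
    cyclicallyLinked⇒nonempty {_ ∷ _} _  = z<s

    cyclicallyLinked-shift : ∀ {C D s} → Shift s C D → CyclicallyLinked R C → CyclicallyLinked R D
    cyclicallyLinked-shift {s = s} sh cl = cyclicallyLinked λ i →
      subst₂ (Related R) (sym (at sh i)) (sym (at sh (suc i))) (step cl (i + s))

    linked⇒nth : ∀ {xs} → Linked R xs → ∀ {i} → suc i < length xs → Related R (nth xs i) (nth xs (suc i))
    linked⇒nth [-]      (s≤s ())
    linked⇒nth (r ∷ _)  {zero}  _        = r
    linked⇒nth (_ ∷ rs) {suc i} (s≤s lt) = linked⇒nth rs lt

    nth⇒linked : ∀ a as → (∀ {i} → suc i < suc (length as) → Related R (nth (a ∷ as) i) (nth (a ∷ as) (suc i))) →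
                 Linked R (a ∷ as)
    nth⇒linked a []       _ = [-]
    nth⇒linked a (b ∷ bs) h = h (s≤s (s≤s z≤n)) ∷ nth⇒linked b bs (λ lt → h (s≤s lt))

    cyclicallyLinked⇔ : ∀ a as → CyclicallyLinked R (a ∷ as) ⇔
                        (Linked R (a ∷ as) × Related R (nth (a ∷ as) (length as)) (just a))
    cyclicallyLinked⇔ a as = mk⇔ to from
      where
      xs = a ∷ as
      wrap : cyclic xs (length xs) ≡ just a
      wrap = cyclic-periodic xs 0
      to : CyclicallyLinked R xs → Linked R xs × Related R (nth xs (length as)) (just a)
      to cl = nth⇒linked a as (λ {i} lt → subst₂ (Related R) (cyclic-< xs (<-trans (n<1+n i) lt)) (cyclic-< xs lt) (step cl i))
            , subst₂ (Related R) (cyclic-< xs (n<1+n _)) wrap (step cl (length as))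
      from : Linked R xs × Related R (nth xs (length as)) (just a) → CyclicallyLinked R xs
      from (lk , close) = cyclicallyLinked (periodic-step (cyclic-periodic xs) (Related R) within)
        where
        within : ∀ {j} → j < length xs → Related R (cyclic xs j) (cyclic xs (suc j))
        within {j} j< with suc j <? length xs
        ... | yes sj< = subst₂ (Related R) (sym (cyclic-< xs j<)) (sym (cyclic-< xs sj<)) (linked⇒nth lk sj<)
        ... | no  sj≮ with refl ← ≤-antisym (s≤s⁻¹ j<) (s≤s⁻¹ (≮⇒≥ sj≮)) =
          subst₂ (Related R) (sym (cyclic-< xs j<)) (sym wrap) close

  pow-[] : ∀ r → pow {A = A} [] r ≡ []
  pow-[] zero    = refl
  pow-[] (suc r) = pow-[] r

  periodic⇒pow : ∀ (C : List A) {g} q → Periodic (cyclic C) (suc g) → length C ≡ q * suc g → C ≡ pow (take (suc g) C) q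
  periodic⇒pow []        zero    _   _ = refl
  periodic⇒pow (_ ∷ _)   zero    _   ()
  periodic⇒pow []        (suc q) _   ()
  periodic⇒pow C@(_ ∷ _) {g} (suc q) per len = cyclic-ext C (pow T (suc q)) len′ λ i → sym (begin
    cyclic (pow T (suc q)) i ≡⟨ cyclic-pow T q i ⟩
    cyclic T i               ≡⟨ cyclic-unique T (subst (0 <_) (sym |T|) z<s) (subst (Periodic (cyclic C)) (sym |T|) per) agree i ⟩
    cyclic C i               ∎)
    where
    T = take (suc g) C
    g<C : suc g ≤ length C
    g<C = subst (suc g ≤_) (sym len) (m≤m+n (suc g) (q * suc g))
    |T| : length T ≡ suc g
    |T| = trans (length-take (suc g) C) (m≤n⇒m⊓n≡m g<C)
    agree : ∀ {j} → j < length T → nth T j ≡ cyclic C j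
    agree {j} j< = trans (nth-take (suc g) C j<′) (sym (cyclic-< C (<-≤-trans j<′ g<C)))
      where j<′ = subst (j <_) |T| j<
    len′ : length C ≡ length (pow T (suc q))
    len′ = trans len (sym (trans (length-pow T (suc q)) (cong (suc q *_) |T|)))

  primitive⇒¬power : ∀ {C D : List A} {r} → Primitive C → 1 < r → C ≢ pow D r
  primitive⇒¬power {D = []} {r} pC _ refl with () ← subst (λ w → 0 < length w) (pow-[] r) (primitive⇒nonempty pC)
  primitive⇒¬power {D = _ ∷ _} {suc zero} _ (s≤s ())
  primitive⇒¬power {D = D@(_ ∷ _)} {suc (suc q)} pC _ refl = <⇒≱ D<C (∣⇒≤ (length∣period pC _ per))
    where
    per : Periodic (cyclic (pow D (suc (suc q)))) (length D)
    per = periodic-≗ (λ i → sym (cyclic-pow D (suc q) i)) (cyclic-periodic D)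
    D<C : length D < length (pow D (suc (suc q)))
    D<C = subst (length D <_) (sym (length-++ D)) (m<m+n (length D) (subst (0 <_) (sym (length-pow D (suc q))) z<s))

  ¬power⇒primitive : ∀ {C : List A} → 0 < length C → (∀ D r → 1 < r → C ≢ pow D r) → Primitive C
  ¬power⇒primitive {C = C} C≢[] notPower = mkPrimitive λ p per → via-gcd p per (Bézout.lemma (suc p) (length C))
    where
    via-gcd : ∀ p → Periodic (cyclic C) (suc p) → Bézout.Lemma (suc p) (length C) → length C ∣ suc p
    via-gcd p per (Bézout.result zero g _) with () ← 0∣⇒≡0 (GCD.gcd∣m g)
    via-gcd p per (Bézout.result (suc d) g b) with GCD.gcd∣n g
    ... | divides q len = by-quotient q len (periodic⇒pow C q (periodic-gcd per (cyclic-periodic C) b) len)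
      where
      by-quotient : ∀ q → length C ≡ q * suc d → C ≡ pow (take (suc d) C) q → length C ∣ suc p
      by-quotient zero          len _  with () ← <⇒≢ C≢[] (sym len)
      by-quotient (suc zero)    len _  = subst (_∣ suc p) (sym (trans len (+-identityʳ (suc d)))) (GCD.gcd∣m g)
      by-quotient (suc (suc q)) _   eq = ⊥-elim (notPower (take (suc d) C) (suc (suc q)) (s≤s (s≤s z≤n)) eq)

  module _ (_≟_ : DecidableEquality A) where

    private
      PowerOfPrefix : List A → ℕ → Set
      PowerOfPrefix C g = suc g < length C × C ≡ pow (take (suc g) C) (length C / suc g)

      powerOfPrefix? : ∀ C g → Dec (PowerOfPrefix C g)
      powerOfPrefix? C g = suc g <? length C ×-dec ≡-dec _≟_ C (pow (take (suc g) C) (length C / suc g))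

      power⇒powerOfPrefix : ∀ {C d ds r} → 1 < r → C ≡ pow (d ∷ ds) r → PowerOfPrefix C (length ds)
      power⇒powerOfPrefix {r = suc zero} (s≤s ())
      power⇒powerOfPrefix {C} {d} {ds} {suc (suc q)} _ refl = D<C , cong₂ pow (sym (take-length-++ D _)) (sym (trans (cong (_/ length D) (length-pow D r)) (m*n/n≡m r (length D))))
        where
        D = d ∷ ds
        r = suc (suc q)
        D<C : length D < length C
        D<C = subst (length D <_) (sym (trans (length-++ D) (cong (length D +_) (length-pow D (suc q)))))
                (m<m+n (length D) z<s)

    primitiveRoot : ∀ (C : List A) → 0 < length C → ∃₂ λ D k → Primitive D × C ≡ pow D (suc k)
    primitiveRoot C = go C (<-wellFounded (length C))
      where
      go : ∀ C → Acc _<_ (length C) → 0 < length C → ∃₂ λ D k → Primitive D × C ≡ pow D (suc k)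
      go C (acc rec) C≢[] with any? (powerOfPrefix? C) (upTo (length C))
      ... | no none = C , 0 , ¬power⇒primitive C≢[] notPower , sym (++-identityʳ C)
        where
        notPower : ∀ D r → 1 < r → C ≢ pow D r
        notPower []       r _   eq with () ← <⇒≢ C≢[] (sym (cong length (trans eq (pow-[] r))))
        notPower (d ∷ ds) r 1<r eq = none (Any.map (λ { refl → power⇒powerOfPrefix 1<r eq }) (∈-upTo⁺ g<C))
          where
          g<C : length ds < length C
          g<C = <-trans (n<1+n _) (proj₁ (power⇒powerOfPrefix 1<r eq))
      ... | yes some with satisfied some
      ...   | g , g<C , C≡ = compose (length C / suc g) C≡ (go T (rec T<C) (subst (0 <_) (sym |T|) z<s))
        where
        T = take (suc g) C
        |T| : length T ≡ suc g
        |T| = trans (length-take (suc g) C) (m≤n⇒m⊓n≡m (<⇒≤ g<C))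
        T<C : length T < length C
        T<C = subst (_< length C) (sym |T|) g<C
        compose : ∀ r → C ≡ pow T r → (∃₂ λ E k → Primitive E × T ≡ pow E (suc k)) →
                  ∃₂ λ E k → Primitive E × C ≡ pow E (suc k)
        compose zero    eq _ with () ← <⇒≢ C≢[] (sym (cong length eq))
        compose (suc r) eq (E , k , pE , T≡) =
          E , k + r * suc k , pE , trans eq (trans (cong (λ w → pow w (suc r)) T≡) (pow-pow E (suc k) (suc r)))

module Circuit where

  open import Defs
  open CyclicWord
  open import Data.Bool.Properties using (not-involutive) renaming (_≟_ to _≟ᵇ_)
  open import Data.Fin.Properties using () renaming (_≟_ to _≟ᶠ_)
  open import Data.List using ([]; _∷_; length)
  import Data.List.Relation.Unary.Linked as Linked
  open import Data.Maybe using (just)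
  open import Data.Nat using (suc; _<_; z<s)
  open import Data.Nat.Properties using (<-trans)
  open import Data.Product using (∃₂; _×_; _,_; proj₁; proj₂)
  open import Data.Product.Properties using (≡-dec)
  open import Function using (_⇔_; mk⇔; Equivalence)
  open import Relation.Binary.PropositionalEquality

  module _ (G : Graph) where

    Step : OEdge G → OEdge G → Set
    Step a b = Composable G a b × NoBacktrack G a b

    inv-involutive : ∀ a → inv G (inv G a) ≡ a
    inv-involutive (e , b) = cong (e ,_) (not-involutive b)

    nth-lastOf : ∀ a as → nth (a ∷ as) (length as) ≡ just (lastOf G a as)
    nth-lastOf a []       = refl
    nth-lastOf a (b ∷ bs) = nth-lastOf b bs

    circuit⇔cyclicallyLinked : ∀ {C} → IsCircuit G C ⇔ CyclicallyLinked Step C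
    circuit⇔cyclicallyLinked {[]}     = mk⇔ (λ ()) (λ cl → CyclicallyLinked.step cl 0)
    circuit⇔cyclicallyLinked {a ∷ as} = mk⇔ to from
      where
      open Equivalence (cyclicallyLinked⇔ {R = Step} a as)
        renaming (to to cyclic⇒linked; from to linked⇒cyclic)
      flip-backtrack : ∀ {b c} → c ≢ inv G b → b ≢ inv G c
      flip-backtrack c≢b⁻¹ b≡c⁻¹ = c≢b⁻¹ (trans (sym (inv-involutive _)) (cong (inv G) (sym b≡c⁻¹)))
      to : IsCircuit G (a ∷ as) → CyclicallyLinked Step (a ∷ as)
      to (lc , closed , lnb , no-tail) =
        linked⇒cyclic (Linked.zip (lc , lnb) , subst (λ z → Related Step z (just a)) (sym (nth-lastOf a as)) (closed , flip-backtrack no-tail))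
      from : CyclicallyLinked Step (a ∷ as) → IsCircuit G (a ∷ as)
      from cl with cyclic⇒linked cl
      ... | lk , close with subst (λ z → Related Step z (just a)) (nth-lastOf a as) close
      ...   | closed , no-tail = proj₁ (Linked.unzip lk) , closed , proj₂ (Linked.unzip lk) , flip-backtrack no-tail

    private
      module CL {C} = Equivalence (circuit⇔cyclicallyLinked {C})

    circuit-shift : ∀ {C D s} → Shift s C D → IsCircuit G C → IsCircuit G D
    circuit-shift {C} {D} sh c = CL.from {D} (cyclicallyLinked-shift sh (CL.to {C} c))

    circuit-pow : ∀ {D} k → IsCircuit G D → IsCircuit G (pow D (suc k))
    circuit-pow k = circuit-shift (shift-pow _ k)

    circuit-rotation : ∀ {C D} → Rotation C D → IsCircuit G C → IsCircuit G D
    circuit-rotation r = circuit-shift (proj₂ (proj₂ (rotation⇒shift r)))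

    circuit⇒nonempty : ∀ {C} → IsCircuit G C → 0 < length C
    circuit⇒nonempty {C} c = cyclicallyLinked⇒nonempty (CL.to {C} c)

    power-circuit⇒circuit : ∀ {D r} → 0 < r → IsCircuit G (pow D r) → IsCircuit G D
    power-circuit⇒circuit {r = suc k} _ = circuit-shift (shift-pow⁻ _ k)

    primeCircuit⇒primitive : ∀ {C} → IsPrimeCircuit G C → Primitive C
    primeCircuit⇒primitive {C} (c , notPower) = ¬power⇒primitive (circuit⇒nonempty c) λ D r 1<r C≡ →
      notPower (D , r , power-circuit⇒circuit (<-trans z<s 1<r) (subst (IsCircuit G) C≡ c) , 1<r , C≡)

    primitiveCircuit⇒primeCircuit : ∀ {C} → IsCircuit G C → Primitive C → IsPrimeCircuit G C
    primitiveCircuit⇒primeCircuit c pC = c , λ (_ , _ , _ , 1<r , C≡) → primitive⇒¬power pC 1<r C≡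

    primeCircuit-rotation : ∀ {C D} → Rotation C D → IsPrimeCircuit G C → IsPrimeCircuit G D
    primeCircuit-rotation r pc = primitiveCircuit⇒primeCircuit (circuit-rotation r (proj₁ pc))
                                   (primitive-rotation (primeCircuit⇒primitive pc) r)

    primeRoot : ∀ {C} → IsCircuit G C → ∃₂ λ D k → IsPrimeCircuit G D × C ≡ pow D (suc k)
    primeRoot {C} c with primitiveRoot (≡-dec _≟ᶠ_ _≟ᵇ_) C (circuit⇒nonempty c)
    ... | D , k , pD , C≡ =
      D , k , primitiveCircuit⇒primeCircuit (power-circuit⇒circuit {r = suc k} z<s (subst (IsCircuit G) C≡ c)) pD , C≡

module Enumeration where

  open import Defs using (EnumUpTo)
  open import Data.Bool using (if_then_else_)
  open import Data.Empty using (⊥; ⊥-elim)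
  open import Data.Fin using (Fin; zero; suc) renaming (_<_ to _<ᶠ_)
  open import Data.Fin.Properties using (pigeonhole)
  open import Data.List using (List; []; _∷_; length; lookup; map; concat; upTo)
  open import Data.List.Membership.Propositional.Properties using (∈-lookup; ∈-upTo⁺; ∈-upTo⁻)
  open import Data.List.Relation.Unary.All as All using (All; []; _∷_)
  import Data.List.Relation.Unary.All.Properties as All
  open import Data.List.Relation.Unary.Any as Any using (Any; here; there)
  import Data.List.Relation.Unary.Any.Properties as Any
  open import Data.List.Relation.Unary.AllPairs using (AllPairs; []; _∷_)
  import Data.List.Relation.Unary.AllPairs.Properties as AllPairs
  open import Data.Nat using (ℕ; _≤_; _<_; _≤?_; s≤s)
  open import Data.Nat.Properties using (≤-antisym; ≰⇒>; <⇒≢; <-trans)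
  open import Data.Product using (∃; ∃₂; _×_; _,_)
  open import Relation.Binary.PropositionalEquality
  open import Relation.Binary.Structures using (IsEquivalence)
  open import Relation.Nullary using (¬_; Dec; yes; no; does)

  open EnumUpTo

  private variable
    A I : Set

  any-with-all : ∀ {P Q : A → Set} {xs} → All P xs → Any Q xs → Any (λ x → P x × Q x) xs
  any-with-all (p ∷ _)  (here q)  = here (p , q)
  any-with-all (_ ∷ ps) (there q) = there (any-with-all ps q)

  allPairs-lookup : ∀ {R : A → A → Set} {xs} → AllPairs R xs → ∀ {i j : Fin (length xs)} → i <ᶠ j →
                    R (lookup xs i) (lookup xs j)
  allPairs-lookup (r ∷ _)  {zero}  {suc j} _        = All.lookup r (∈-lookup j)
  allPairs-lookup (_ ∷ rs) {suc i} {suc j} (s≤s lt) = allPairs-lookup rs lt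

  module _ {_≈_ : A → A → Set} (isEquivalence : IsEquivalence _≈_) {P : A → Set} where

    open IsEquivalence isEquivalence renaming (sym to ≈-sym; trans to ≈-trans)

    private
      length-≤ : ∀ {xs ys} → All P xs → AllPairs (λ x y → ¬ x ≈ y) xs → (∀ x → P x → Any (x ≈_) ys) →
                 length xs ≤ length ys
      length-≤ {xs} {ys} px distinct covered with length xs ≤? length ys
      ... | yes le = le
      ... | no  gt = ⊥-elim (collision (pigeonhole (≰⇒> gt) slot))
        where
        cover : ∀ i → Any (lookup xs i ≈_) ys
        cover i = covered (lookup xs i) (All.lookup px (∈-lookup i))
        slot : Fin (length xs) → Fin (length ys)
        slot i = Any.index (cover i)
        lookup-slot : ∀ i → lookup xs i ≈ lookup ys (slot i)
        lookup-slot i = Any.lookup-index (cover i)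
        collision : (∃₂ λ i j → i <ᶠ j × slot i ≡ slot j) → ⊥
        collision (i , j , i<j , same) = allPairs-lookup distinct i<j
          (≈-trans (lookup-slot i) (≈-sym (subst (λ s → lookup xs j ≈ lookup ys s) (sym same) (lookup-slot j))))

    enum-length-unique : ∀ {xs ys} → EnumUpTo _≈_ P xs → EnumUpTo _≈_ P ys → length xs ≡ length ys
    enum-length-unique e f = ≤-antisym (length-≤ (sound e) (distinct e) (complete f))
                                       (length-≤ (sound f) (distinct f) (complete e))

  module _ {_≈_ : A → A → Set} where

    enum-⇔ : ∀ {P Q : A → Set} {xs} → (∀ {x} → P x → Q x) → (∀ {x} → Q x → P x) →
             EnumUpTo _≈_ P xs → EnumUpTo _≈_ Q xs
    enum-⇔ P⇒Q Q⇒P e = record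
      { sound    = All.map P⇒Q (sound e)
      ; distinct = distinct e
      ; complete = λ x qx → complete e x (Q⇒P qx)
      }

    enum-if : ∀ {Q : Set} {P : A → Set} (Q? : Dec Q) {xs} → (Q → EnumUpTo _≈_ P xs) → (∀ {x} → P x → Q) →
              EnumUpTo _≈_ P (if does Q? then xs else [])
    enum-if (yes q) e _   = e q
    enum-if (no ¬q) _ P⇒Q = record { sound = [] ; distinct = [] ; complete = λ _ px → ⊥-elim (¬q (P⇒Q px)) }

    enum-upTo : ∀ {P : A → Set} (f : ℕ → A) n → (∀ {i j} → i < n → j < n → f i ≈ f j → i ≡ j) →
                (∀ {i} → i < n → P (f i)) → (∀ x → P x → ∃ λ i → i < n × x ≈ f i) →
                EnumUpTo _≈_ P (map f (upTo n))
    enum-upTo f n injective member covered = record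
      { sound    = All.map⁺ (All.tabulate (λ i∈ → member (∈-upTo⁻ i∈)))
      ; distinct = AllPairs.map⁺ (AllPairs.applyUpTo⁺₁ (λ i → i) n
                     (λ i<j j<n fi≈fj → <⇒≢ i<j (injective (<-trans i<j j<n) j<n fi≈fj)))
      ; complete = λ x px → let (i , i<n , x≈fi) = covered x px in
                     Any.map⁺ (Any.map (λ { refl → x≈fi }) (∈-upTo⁺ i<n))
      }

  module _ {B : Set} {_≈_ : A → A → Set} {_≈′_ : B → B → Set} {P : A → Set} {Q : B → Set} where

    enum-map : ∀ (f : A → B) {xs} → EnumUpTo _≈_ P xs →
               (∀ {x y} → P x → P y → f x ≈′ f y → x ≈ y) → (∀ {x} → P x → Q (f x)) →
               (∀ y → Q y → ∃ λ x → P x × (∀ {x′} → P x′ → x ≈ x′ → y ≈′ f x′)) →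
               EnumUpTo _≈′_ Q (map f xs)
    enum-map f {xs} e reflects preserves covered = record
      { sound    = All.map⁺ (All.map preserves (sound e))
      ; distinct = AllPairs.map⁺ (unrelated xs (sound e) (distinct e))
      ; complete = λ y qy → let (x , px , near) = covered y qy in
                     Any.map⁺ (Any.map (λ (px′ , x≈x′) → near px′ x≈x′) (any-with-all (sound e) (complete e x px)))
      }
      where
      unrelated : ∀ ys → All P ys → AllPairs (λ x y → ¬ x ≈ y) ys → AllPairs (λ x y → ¬ f x ≈′ f y) ys
      unrelated []       _        _        = []
      unrelated (y ∷ ys) (py ∷ ps) (d ∷ ds) =
        All.zipWith (λ (py′ , ¬y≈) fy≈ → ¬y≈ (reflects py py′ fy≈)) (ps , d) ∷ unrelated ys ps ds

  module _ {_∼_ : I → I → Set} {_≈_ : A → A → Set} where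

    private
      across : ∀ {Pᵢ : I → A → Set} (blocks : I → List A) → (∀ {i j x y} → Pᵢ i x → Pᵢ j y → x ≈ y → i ∼ j) →
               ∀ {i x} → Pᵢ i x → ∀ js → All (λ j → ¬ i ∼ j) js → All (λ j → All (Pᵢ j) (blocks j)) js →
               All (λ y → ¬ x ≈ y) (concat (map blocks js))
      across blocks separated px []       _        _        = []
      across blocks separated px (j ∷ js) (i≁j ∷ ns) (pj ∷ ps) =
        All.++⁺ (All.map (λ py x≈y → i≁j (separated px py x≈y)) pj) (across blocks separated px js ns ps)

      concat-distinct : ∀ {Pᵢ : I → A → Set} (blocks : I → List A) → (∀ {i j x y} → Pᵢ i x → Pᵢ j y → x ≈ y → i ∼ j) →
                        ∀ is → AllPairs (λ i j → ¬ i ∼ j) is → All (λ i → EnumUpTo _≈_ (Pᵢ i) (blocks i)) is →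
                        AllPairs (λ x y → ¬ x ≈ y) (concat (map blocks is))
      concat-distinct blocks separated []       _          _        = []
      concat-distinct blocks separated (i ∷ is) (i≁ ∷ ns) (e ∷ es) =
        AllPairs.++⁺ (distinct e) (concat-distinct blocks separated is ns es)
          (All.map (λ px → across blocks separated px is i≁ (All.map sound es)) (sound e))

    enum-concat : ∀ {P : A → Set} {Pᵢ : I → A → Set} (blocks : I → List A) {is} →
                  AllPairs (λ i j → ¬ i ∼ j) is →
                  All (λ i → EnumUpTo _≈_ (Pᵢ i) (blocks i)) is →
                  (∀ {i j x y} → Pᵢ i x → Pᵢ j y → x ≈ y → i ∼ j) →
                  All (λ i → ∀ {x} → Pᵢ i x → P x) is →
                  (∀ x → P x → Any (λ i → Pᵢ i x) is) →
                  EnumUpTo _≈_ P (concat (map blocks is))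
    enum-concat {P} {Pᵢ} blocks {is} is-distinct es separated inside covered = record
      { sound    = All.concat⁺ (All.map⁺ (All.zipWith block-sound (es , inside)))
      ; distinct = concat-distinct blocks separated is is-distinct es
      ; complete = λ x px → Any.concat⁺ (Any.map⁺ (Any.map (λ (e , pix) → complete e x pix) (any-with-all es (covered x px))))
      }
      where
      block-sound : ∀ {i} → EnumUpTo _≈_ (Pᵢ i) (blocks i) × (∀ {x} → Pᵢ i x → P x) → All P (blocks i)
      block-sound (e , inside-i) = All.map inside-i (sound e)

module DivisorSum where

  open import Defs using (sumℤ; sumℕ; divSumℤ; divSumℕ; range1; EnumUpTo)
  open Enumeration using (enum-concat; enum-if; enum-⇔)
  open import Data.Bool using (Bool; true; false; if_then_else_)
  open import Data.Empty using (⊥-elim)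
  open import Data.Integer as ℤ using (ℤ; +_; _+_; _*_; -_)
  import Data.Integer.Properties as ℤ
  open import Data.List using (List; []; _∷_; _++_; [_]; length; map; concat; upTo)
  import Data.List.Properties as List
  import Data.Nat.ListAction.Properties as ListAction
  open import Data.List.Membership.Propositional using (_∈_; lose)
  open import Data.List.Membership.Propositional.Properties using (∈-map⁺; ∈-map⁻; ∈-upTo⁺; ∈-upTo⁻)
  import Data.List.Relation.Unary.All as All
  open import Data.List.Relation.Unary.Any using (Any; here; there)
  open import Data.List.Relation.Unary.AllPairs using (AllPairs)
  import Data.List.Relation.Unary.AllPairs.Properties as AllPairs
  open import Data.Nat as ℕ using (ℕ; zero; suc; _≤_; _<_; z≤n; s≤s; _≟_)
  import Data.Nat.Properties as ℕ
  open import Data.Nat.Divisibility using (_∣?_; divides)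
  open import Data.Product using (∃; ∃₂; _×_; _,_; proj₁; proj₂)
  open import Function using (_∘_)
  open import Relation.Binary.PropositionalEquality hiding ([_])
  open import Relation.Nullary using (¬_; Dec; yes; no; does)

  open ≡-Reasoning

  ∈-range1⁺ : ∀ {n x} → 1 ≤ x → x ≤ n → x ∈ range1 n
  ∈-range1⁺ {x = suc x} _ x≤n = ∈-map⁺ suc (∈-upTo⁺ x≤n)

  ∈-range1⁻ : ∀ {n x} → x ∈ range1 n → 1 ≤ x × x ≤ n
  ∈-range1⁻ x∈ with ∈-map⁻ suc x∈
  ... | _ , y∈ , refl = s≤s z≤n , ∈-upTo⁻ y∈

  range1-suc : ∀ n → range1 (suc n) ≡ range1 n ++ [ suc n ]
  range1-suc n = trans (cong (map suc) (sym (List.upTo-∷ʳ n))) (List.map-++ suc (upTo n) [ n ])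

  ∑ : List ℕ → (ℕ → ℤ) → ℤ
  ∑ xs f = sumℤ (map f xs)

  [_]·_ : Bool → ℤ → ℤ
  [ b ]· x = if b then x else + 0

  sumℤ-++ : ∀ xs ys → sumℤ (xs ++ ys) ≡ sumℤ xs + sumℤ ys
  sumℤ-++ []       ys = sym (ℤ.+-identityˡ _)
  sumℤ-++ (x ∷ xs) ys = trans (cong (_+_ x) (sumℤ-++ xs ys)) (sym (ℤ.+-assoc x _ _))

  ∑-range1-suc : ∀ n f → ∑ (range1 (suc n)) f ≡ ∑ (range1 n) f + f (suc n)
  ∑-range1-suc n f = begin
    sumℤ (map f (range1 (suc n)))                ≡⟨ cong (sumℤ ∘ map f) (range1-suc n) ⟩
    sumℤ (map f (range1 n ++ [ suc n ]))         ≡⟨ cong sumℤ (List.map-++ f (range1 n) [ suc n ]) ⟩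
    sumℤ (map f (range1 n) ++ [ f (suc n) ])     ≡⟨ sumℤ-++ (map f (range1 n)) _ ⟩
    ∑ (range1 n) f + (f (suc n) + + 0)           ≡⟨ cong (_+_ (∑ (range1 n) f)) (ℤ.+-identityʳ _) ⟩
    ∑ (range1 n) f + f (suc n)                   ∎

  ∑-cong-∈ : ∀ xs {f g : ℕ → ℤ} → (∀ {x} → x ∈ xs → f x ≡ g x) → ∑ xs f ≡ ∑ xs g
  ∑-cong-∈ []       _   = refl
  ∑-cong-∈ (x ∷ xs) f≗g = cong₂ _+_ (f≗g (here refl)) (∑-cong-∈ xs (f≗g ∘ there))

  ∑-cong : ∀ xs {f g : ℕ → ℤ} → (∀ x → f x ≡ g x) → ∑ xs f ≡ ∑ xs g
  ∑-cong xs f≗g = ∑-cong-∈ xs (λ {x} _ → f≗g x)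

  ∑-cong-range : ∀ n {f g : ℕ → ℤ} → (∀ {x} → 1 ≤ x → x ≤ n → f x ≡ g x) → ∑ (range1 n) f ≡ ∑ (range1 n) g
  ∑-cong-range n f≗g = ∑-cong-∈ (range1 n) (λ x∈ → let (1≤x , x≤n) = ∈-range1⁻ x∈ in f≗g 1≤x x≤n)

  ∑-zero : ∀ xs → ∑ xs (λ _ → + 0) ≡ + 0
  ∑-zero []       = refl
  ∑-zero (_ ∷ xs) = trans (ℤ.+-identityˡ _) (∑-zero xs)

  ∑-+ : ∀ xs (f g : ℕ → ℤ) → ∑ xs (λ x → f x + g x) ≡ ∑ xs f + ∑ xs g
  ∑-+ []       f g = refl
  ∑-+ (x ∷ xs) f g = trans (cong (_+_ (f x + g x)) (∑-+ xs f g)) (swap-middle (f x) (g x) _ _)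
    where
    swap-middle : ∀ a b c d → a + b + (c + d) ≡ a + c + (b + d)
    swap-middle a b c d = begin
      a + b + (c + d)   ≡⟨ ℤ.+-assoc a b (c + d) ⟩
      a + (b + (c + d)) ≡⟨ cong (_+_ a) (ℤ.+-assoc b c d) ⟨
      a + (b + c + d)   ≡⟨ cong (λ z → a + (z + d)) (ℤ.+-comm b c) ⟩
      a + (c + b + d)   ≡⟨ cong (_+_ a) (ℤ.+-assoc c b d) ⟩
      a + (c + (b + d)) ≡⟨ ℤ.+-assoc a c (b + d) ⟨
      a + c + (b + d)   ∎

  ∑-swap : ∀ xs ys (h : ℕ → ℕ → ℤ) → ∑ xs (λ x → ∑ ys (h x)) ≡ ∑ ys (λ y → ∑ xs (λ x → h x y))
  ∑-swap xs []       h = ∑-zero xs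
  ∑-swap xs (y ∷ ys) h = trans (∑-+ xs (λ x → h x y) (λ x → ∑ ys (h x))) (cong (_+_ (∑ xs (λ x → h x y))) (∑-swap xs ys h))

  ∑-*ˡ : ∀ xs c (f : ℕ → ℤ) → c * ∑ xs f ≡ ∑ xs (λ x → c * f x)
  ∑-*ˡ []       c f = ℤ.*-zeroʳ c
  ∑-*ˡ (x ∷ xs) c f = trans (ℤ.*-distribˡ-+ c (f x) (∑ xs f)) (cong (_+_ (c * f x)) (∑-*ˡ xs c f))

  ∑-neg : ∀ xs (f : ℕ → ℤ) → ∑ xs (λ x → - f x) ≡ - ∑ xs f
  ∑-neg []       f = refl
  ∑-neg (x ∷ xs) f = trans (cong (_+_ (- f x)) (∑-neg xs f)) (sym (ℤ.neg-distrib-+ (f x) (∑ xs f)))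

  []·-∑ : ∀ b xs (f : ℕ → ℤ) → [ b ]· ∑ xs f ≡ ∑ xs (λ x → [ b ]· f x)
  []·-∑ true  xs f = refl
  []·-∑ false xs f = sym (∑-zero xs)

  []·-*ʳ : ∀ b c x → c * [ b ]· x ≡ [ b ]· (c * x)
  []·-*ʳ true  c x = refl
  []·-*ʳ false c x = ℤ.*-zeroʳ c

  []·-comm : ∀ a b x → [ a ]· [ b ]· x ≡ [ b ]· [ a ]· x
  []·-comm true  b     x = refl
  []·-comm false true  x = refl
  []·-comm false false x = refl

  []·-neg : ∀ b x → - [ b ]· x ≡ [ b ]· (- x)
  []·-neg true  x = refl
  []·-neg false x = refl

  []·-no : ∀ {P : Set} (P? : Dec P) {x} → ¬ P → [ does P? ]· x ≡ + 0
  []·-no (yes p) ¬p = ⊥-elim (¬p p)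
  []·-no (no _)  _  = refl

  []·-yes : ∀ {P : Set} (P? : Dec P) {x} → P → [ does P? ]· x ≡ x
  []·-yes (yes _) _ = refl
  []·-yes (no ¬p) p = ⊥-elim (¬p p)

  []·-cong : ∀ {P Q : Set} (P? : Dec P) (Q? : Dec Q) {x y} → (P → Q) → (Q → P) → (P → x ≡ y) →
             [ does P? ]· x ≡ [ does Q? ]· y
  []·-cong (yes p) (yes q) _   _   x≡y = x≡y p
  []·-cong (yes p) (no ¬q) P⇒Q _   _   = ⊥-elim (¬q (P⇒Q p))
  []·-cong (no ¬p) (yes q) _   Q⇒P _   = ⊥-elim (¬p (Q⇒P q))
  []·-cong (no _)  (no _)  _   _   _   = refl

  ∑-point : ∀ n {c} (F : ℕ → ℤ) → 1 ≤ c → (n < c → F c ≡ + 0) → ∑ (range1 n) (λ x → [ does (x ≟ c) ]· F x) ≡ F c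
  ∑-point zero    F 1≤c outside = sym (outside 1≤c)
  ∑-point (suc n) {c} F 1≤c outside with c ≟ suc n
  ... | yes refl = begin
    ∑ (range1 (suc n)) (λ x → [ does (x ≟ c) ]· F x)           ≡⟨ ∑-range1-suc n _ ⟩
    ∑ (range1 n) (λ x → [ does (x ≟ c) ]· F x) + [ does (c ≟ c) ]· F c
      ≡⟨ cong₂ _+_ (trans (∑-cong-range n (λ {x} _ x≤n → []·-no (x ≟ c) (ℕ.<⇒≢ (s≤s x≤n)))) (∑-zero (range1 n)))
                   ([]·-yes (c ≟ c) refl) ⟩
    + 0 + F c                                                 ≡⟨ ℤ.+-identityˡ (F c) ⟩
    F c                                                       ∎
  ... | no c≢ = begin
    ∑ (range1 (suc n)) (λ x → [ does (x ≟ c) ]· F x)           ≡⟨ ∑-range1-suc n _ ⟩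
    ∑ (range1 n) (λ x → [ does (x ≟ c) ]· F x) + [ does (suc n ≟ c) ]· F (suc n)
      ≡⟨ cong₂ _+_ (∑-point n F 1≤c (λ n<c → outside (ℕ.≤∧≢⇒< n<c (c≢ ∘ sym)))) ([]·-no (suc n ≟ c) (c≢ ∘ sym)) ⟩
    F c + + 0                                                 ≡⟨ ℤ.+-identityʳ (F c) ⟩
    F c                                                       ∎

  ∑-extend : ∀ {m n} (f : ℕ → ℤ) → m ≤ n → (∀ {x} → m < x → x ≤ n → f x ≡ + 0) → ∑ (range1 n) f ≡ ∑ (range1 m) f
  ∑-extend {m} {zero}  f m≤0 _ with z≤n ← m≤0 = refl
  ∑-extend {m} {suc n} f m≤ vanish with m ≟ suc n
  ... | yes refl = refl
  ... | no  m≢ = begin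
    ∑ (range1 (suc n)) f       ≡⟨ ∑-range1-suc n f ⟩
    ∑ (range1 n) f + f (suc n) ≡⟨ cong₂ _+_ (∑-extend f m≤n (λ m<x x≤n → vanish m<x (ℕ.m≤n⇒m≤1+n x≤n))) (vanish (s≤s m≤n) ℕ.≤-refl) ⟩
    ∑ (range1 m) f + + 0       ≡⟨ ℤ.+-identityʳ _ ⟩
    ∑ (range1 m) f             ∎
    where
    m≤n : m ≤ n
    m≤n = ℕ.≤-pred (ℕ.≤∧≢⇒< m≤ m≢)

  ∑-sink : ∀ ws xs ys zs (F : ℕ → ℕ → ℕ → ℕ → ℤ) →
           ∑ ws (λ w → ∑ xs (λ x → ∑ ys (λ y → ∑ zs (λ z → F w x y z)))) ≡
           ∑ xs (λ x → ∑ ys (λ y → ∑ zs (λ z → ∑ ws (λ w → F w x y z))))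
  ∑-sink ws xs ys zs F = begin
    ∑ ws (λ w → ∑ xs (λ x → ∑ ys (λ y → ∑ zs (λ z → F w x y z))))
      ≡⟨ ∑-swap ws xs _ ⟩
    ∑ xs (λ x → ∑ ws (λ w → ∑ ys (λ y → ∑ zs (λ z → F w x y z))))
      ≡⟨ ∑-cong xs (λ x → ∑-swap ws ys _) ⟩
    ∑ xs (λ x → ∑ ys (λ y → ∑ ws (λ w → ∑ zs (λ z → F w x y z))))
      ≡⟨ ∑-cong xs (λ x → ∑-cong ys (λ y → ∑-swap ws zs _)) ⟩
    ∑ xs (λ x → ∑ ys (λ y → ∑ zs (λ z → ∑ ws (λ w → F w x y z))))
      ∎

  private
    m≤m*n⁺ : ∀ {m n} → 1 ≤ n → m ≤ m ℕ.* n
    m≤m*n⁺ {m} {n@(suc _)} _ = ℕ.m≤m*n m n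

    n≤m*n⁺ : ∀ {m n} → 1 ≤ m → n ≤ m ℕ.* n
    n≤m*n⁺ {m@(suc _)} {n} _ = ℕ.m≤n*m n m

  divSumℤ-∑ : ∀ l f → divSumℤ l f ≡ ∑ (range1 l) (λ d → ∑ (range1 l) (λ k → [ does (d ℕ.* k ≟ l) ]· f d k))
  divSumℤ-∑ l f = go (range1 l)
    where
    go : ∀ ds → sumℤ (concat (map (λ d → map (λ k → [ does (d ℕ.* k ≟ l) ]· f d k) (range1 l)) ds)) ≡
                ∑ ds (λ d → ∑ (range1 l) (λ k → [ does (d ℕ.* k ≟ l) ]· f d k))
    go []       = refl
    go (d ∷ ds) = trans (sumℤ-++ (map (λ k → [ does (d ℕ.* k ≟ l) ]· f d k) (range1 l)) _) (cong (_+_ (∑ (range1 l) (λ k → [ does (d ℕ.* k ≟ l) ]· f d k))) (go ds))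

  divSumℤ-extend : ∀ {l n} f → l ≤ n →
                   divSumℤ l f ≡ ∑ (range1 n) (λ d → ∑ (range1 n) (λ k → [ does (d ℕ.* k ≟ l) ]· f d k))
  divSumℤ-extend {l} {n} f l≤n = begin
    divSumℤ l f                                                            ≡⟨ divSumℤ-∑ l f ⟩
    ∑ (range1 l) (λ d → ∑ (range1 l) (λ k → [ does (d ℕ.* k ≟ l) ]· f d k))
      ≡⟨ ∑-cong-range l (λ {d} 1≤d _ → ∑-extend _ l≤n (λ {k} l<k _ → []·-no (d ℕ.* k ≟ l) (too-big l<k (n≤m*n⁺ 1≤d)))) ⟨
    ∑ (range1 l) (λ d → ∑ (range1 n) (λ k → [ does (d ℕ.* k ≟ l) ]· f d k))
      ≡⟨ ∑-extend _ l≤n (λ {d} l<d _ → trans (∑-cong-range n (λ {k} 1≤k _ → []·-no (d ℕ.* k ≟ l) (too-big l<d (m≤m*n⁺ 1≤k)))) (∑-zero (range1 n))) ⟨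
    ∑ (range1 n) (λ d → ∑ (range1 n) (λ k → [ does (d ℕ.* k ≟ l) ]· f d k)) ∎
    where
    too-big : ∀ {x y} → l < x → x ≤ y → y ≢ l
    too-big l<x x≤y refl = ℕ.<⇒≱ l<x x≤y

  divSumℤ-cong : ∀ l {f g} → (∀ {d k} → d ℕ.* k ≡ l → f d k ≡ g d k) → divSumℤ l f ≡ divSumℤ l g
  divSumℤ-cong l {f} {g} f≗g = begin
    divSumℤ l f ≡⟨ divSumℤ-∑ l f ⟩
    ∑ (range1 l) (λ d → ∑ (range1 l) (λ k → [ does (d ℕ.* k ≟ l) ]· f d k))
      ≡⟨ ∑-cong (range1 l) (λ d → ∑-cong (range1 l) (λ k → []·-cong (d ℕ.* k ≟ l) (d ℕ.* k ≟ l) (λ e → e) (λ e → e) f≗g)) ⟩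
    ∑ (range1 l) (λ d → ∑ (range1 l) (λ k → [ does (d ℕ.* k ≟ l) ]· g d k))
      ≡⟨ divSumℤ-∑ l g ⟨
    divSumℤ l g ∎

  divSumℤ-*ˡ : ∀ l c f → c * divSumℤ l f ≡ divSumℤ l (λ d k → c * f d k)
  divSumℤ-*ˡ l c f = begin
    c * divSumℤ l f ≡⟨ cong (c *_) (divSumℤ-∑ l f) ⟩
    c * ∑ (range1 l) (λ d → ∑ (range1 l) (λ k → [ does (d ℕ.* k ≟ l) ]· f d k))
      ≡⟨ ∑-*ˡ (range1 l) c _ ⟩
    ∑ (range1 l) (λ d → c * ∑ (range1 l) (λ k → [ does (d ℕ.* k ≟ l) ]· f d k))
      ≡⟨ ∑-cong (range1 l) (λ d → trans (∑-*ˡ (range1 l) c _) (∑-cong (range1 l) (λ k → []·-*ʳ (does (d ℕ.* k ≟ l)) c (f d k)))) ⟩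
    ∑ (range1 l) (λ d → ∑ (range1 l) (λ k → [ does (d ℕ.* k ≟ l) ]· (c * f d k)))
      ≡⟨ divSumℤ-∑ l _ ⟨
    divSumℤ l (λ d k → c * f d k) ∎

  divSumℤ-point : ∀ {l} → 1 ≤ l → (g : ℕ → ℕ → ℤ) → divSumℤ l (λ d m → [ does (m ≟ 1) ]· g d m) ≡ g l 1
  divSumℤ-point {l} 1≤l g = begin
    divSumℤ l (λ d m → [ does (m ≟ 1) ]· g d m) ≡⟨ divSumℤ-∑ l _ ⟩
    ∑ (range1 l) (λ d → ∑ (range1 l) (λ m → [ does (d ℕ.* m ≟ l) ]· [ does (m ≟ 1) ]· g d m))
      ≡⟨ ∑-cong (range1 l) (λ d → trans (∑-cong (range1 l) (λ m → []·-comm (does (d ℕ.* m ≟ l)) (does (m ≟ 1)) (g d m)))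
                                         (∑-point l (λ m → [ does (d ℕ.* m ≟ l) ]· g d m) (s≤s z≤n) (λ l<1 → ⊥-elim (ℕ.<⇒≱ l<1 1≤l)))) ⟩
    ∑ (range1 l) (λ d → [ does (d ℕ.* 1 ≟ l) ]· g d 1)
      ≡⟨ ∑-cong (range1 l) (λ d → []·-cong (d ℕ.* 1 ≟ l) (d ≟ l) (trans (sym (ℕ.*-identityʳ d))) (trans (ℕ.*-identityʳ d)) (λ _ → refl)) ⟩
    ∑ (range1 l) (λ d → [ does (d ≟ l) ]· g d 1)
      ≡⟨ ∑-point l (λ d → g d 1) 1≤l (λ l<l → ⊥-elim (ℕ.<-irrefl refl l<l)) ⟩
    g l 1 ∎

  []·-divSumℤ : ∀ b {d n} f → d ≤ n →
                [ b ]· divSumℤ d f ≡ ∑ (range1 n) (λ x → ∑ (range1 n) (λ y → [ b ]· [ does (x ℕ.* y ≟ d) ]· f x y))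
  []·-divSumℤ b {d} {n} f d≤n = begin
    [ b ]· divSumℤ d f
      ≡⟨ cong ([ b ]·_) (divSumℤ-extend f d≤n) ⟩
    [ b ]· ∑ (range1 n) (λ x → ∑ (range1 n) (λ y → [ does (x ℕ.* y ≟ d) ]· f x y))
      ≡⟨ []·-∑ b (range1 n) _ ⟩
    ∑ (range1 n) (λ x → [ b ]· ∑ (range1 n) (λ y → [ does (x ℕ.* y ≟ d) ]· f x y))
      ≡⟨ ∑-cong (range1 n) (λ x → []·-∑ b (range1 n) _) ⟩
    ∑ (range1 n) (λ x → ∑ (range1 n) (λ y → [ b ]· [ does (x ℕ.* y ≟ d) ]· f x y)) ∎

  private
    Triple : ℕ → (ℕ → ℕ → ℕ → ℤ) → ℤ
    Triple l h = ∑ (range1 l) (λ a → ∑ (range1 l) (λ b → ∑ (range1 l) (λ k → [ does (a ℕ.* b ℕ.* k ≟ l) ]· h a b k)))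

    substitute : ∀ l {c} (F : ℕ → ℤ) → 1 ≤ c → (l < c → F c ≡ + 0) → ∑ (range1 l) (λ x → [ does (c ≟ x) ]· F x) ≡ F c
    substitute l {c} F 1≤c outside =
      trans (∑-cong (range1 l) (λ x → []·-cong (c ≟ x) (x ≟ c) sym sym (λ _ → refl))) (∑-point l F 1≤c outside)

    1≤* : ∀ {m n} → 1 ≤ m → 1 ≤ n → 1 ≤ m ℕ.* n
    1≤* {suc _} {suc _} _ _ = s≤s z≤n

    eliminate : ∀ l {c k} (h : ℤ) → 1 ≤ c → 1 ≤ k →
                ∑ (range1 l) (λ d → [ does (d ℕ.* k ≟ l) ]· [ does (c ≟ d) ]· h) ≡ [ does (c ℕ.* k ≟ l) ]· h
    eliminate l {c} {k} h 1≤c 1≤k = begin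
      ∑ (range1 l) (λ d → [ does (d ℕ.* k ≟ l) ]· [ does (c ≟ d) ]· h)
        ≡⟨ ∑-cong (range1 l) (λ d → []·-comm (does (d ℕ.* k ≟ l)) (does (c ≟ d)) h) ⟩
      ∑ (range1 l) (λ d → [ does (c ≟ d) ]· [ does (d ℕ.* k ≟ l) ]· h)
        ≡⟨ substitute l (λ d → [ does (d ℕ.* k ≟ l) ]· h) 1≤c
             (λ l<c → []·-no (c ℕ.* k ≟ l) (λ ck≡l → ℕ.<⇒≱ l<c (subst (c ≤_) ck≡l (m≤m*n⁺ 1≤k)))) ⟩
      [ does (c ℕ.* k ≟ l) ]· h ∎

    divSumℤ-nestedˡ : ∀ l h → divSumℤ l (λ d k → divSumℤ d (λ a b → h a b k)) ≡ Triple l h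
    divSumℤ-nestedˡ l h = begin
      divSumℤ l (λ d k → divSumℤ d (λ a b → h a b k))
        ≡⟨ divSumℤ-∑ l _ ⟩
      ∑ R (λ d → ∑ R (λ k → [ does (d ℕ.* k ≟ l) ]· divSumℤ d (λ a b → h a b k)))
        ≡⟨ ∑-cong-range l (λ {d} _ d≤l → ∑-cong R (λ k → []·-divSumℤ (does (d ℕ.* k ≟ l)) (λ a b → h a b k) d≤l)) ⟩
      ∑ R (λ d → ∑ R (λ k → ∑ R (λ a → ∑ R (λ b → [ does (d ℕ.* k ≟ l) ]· [ does (a ℕ.* b ≟ d) ]· h a b k))))
        ≡⟨ ∑-sink R R R R _ ⟩
      ∑ R (λ k → ∑ R (λ a → ∑ R (λ b → ∑ R (λ d → [ does (d ℕ.* k ≟ l) ]· [ does (a ℕ.* b ≟ d) ]· h a b k))))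
        ≡⟨ ∑-cong-range l (λ {k} 1≤k _ → ∑-cong-range l (λ {a} 1≤a _ → ∑-cong-range l (λ {b} 1≤b _ →
             eliminate l (h a b k) (1≤* 1≤a 1≤b) 1≤k))) ⟩
      ∑ R (λ k → ∑ R (λ a → ∑ R (λ b → [ does (a ℕ.* b ℕ.* k ≟ l) ]· h a b k)))
        ≡⟨ ∑-swap R R _ ⟩
      ∑ R (λ a → ∑ R (λ k → ∑ R (λ b → [ does (a ℕ.* b ℕ.* k ≟ l) ]· h a b k)))
        ≡⟨ ∑-cong R (λ a → ∑-swap R R _) ⟩
      Triple l h ∎
      where R = range1 l

    divSumℤ-nestedʳ : ∀ l h → divSumℤ l (λ a m → divSumℤ m (λ k b → h a b k)) ≡ Triple l h
    divSumℤ-nestedʳ l h = begin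
      divSumℤ l (λ a m → divSumℤ m (λ k b → h a b k))
        ≡⟨ divSumℤ-∑ l _ ⟩
      ∑ R (λ a → ∑ R (λ m → [ does (a ℕ.* m ≟ l) ]· divSumℤ m (λ k b → h a b k)))
        ≡⟨ ∑-cong R (λ a → ∑-cong-range l (λ {m} _ m≤l → []·-divSumℤ (does (a ℕ.* m ≟ l)) (λ k b → h a b k) m≤l)) ⟩
      ∑ R (λ a → ∑ R (λ m → ∑ R (λ k → ∑ R (λ b → [ does (a ℕ.* m ≟ l) ]· [ does (k ℕ.* b ≟ m) ]· h a b k))))
        ≡⟨ ∑-cong R (λ a → trans (∑-swap R R _) (∑-cong R (λ k → ∑-swap R R _))) ⟩
      ∑ R (λ a → ∑ R (λ k → ∑ R (λ b → ∑ R (λ m → [ does (a ℕ.* m ≟ l) ]· [ does (k ℕ.* b ≟ m) ]· h a b k))))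
        ≡⟨ ∑-cong-range l (λ {a} 1≤a _ → ∑-cong-range l (λ {k} 1≤k _ → ∑-cong-range l (λ {b} 1≤b _ →
             trans (∑-cong R (λ m → cong (λ z → [ does (z ≟ l) ]· [ does (k ℕ.* b ≟ m) ]· h a b k) (ℕ.*-comm a m)))
                   (eliminate l (h a b k) (1≤* 1≤k 1≤b) 1≤a)))) ⟩
      ∑ R (λ a → ∑ R (λ k → ∑ R (λ b → [ does (k ℕ.* b ℕ.* a ≟ l) ]· h a b k)))
        ≡⟨ ∑-cong R (λ a → ∑-swap R R _) ⟩
      ∑ R (λ a → ∑ R (λ b → ∑ R (λ k → [ does (k ℕ.* b ℕ.* a ≟ l) ]· h a b k)))
        ≡⟨ ∑-cong R (λ a → ∑-cong R (λ b → ∑-cong R (λ k → cong (λ z → [ does (z ≟ l) ]· h a b k) (reorder a b k)))) ⟩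
      Triple l h ∎
      where
      R = range1 l
      reorder : ∀ a b k → k ℕ.* b ℕ.* a ≡ a ℕ.* b ℕ.* k
      reorder = solve 3 (λ a b k → k :* b :* a := a :* b :* k) refl
        where open import Data.Nat.Solver using (module +-*-Solver)
              open +-*-Solver

  divSumℤ-assoc : ∀ l (h : ℕ → ℕ → ℕ → ℤ) →
                  divSumℤ l (λ d k → divSumℤ d (λ a b → h a b k)) ≡ divSumℤ l (λ a m → divSumℤ m (λ k b → h a b k))
  divSumℤ-assoc l h = trans (divSumℤ-nestedˡ l h) (sym (divSumℤ-nestedʳ l h))

  +-sumℕ : ∀ xs → + sumℕ xs ≡ sumℤ (map (λ n → + n) xs)
  +-sumℕ []       = refl
  +-sumℕ (x ∷ xs) = trans (ℤ.pos-+ x (sumℕ xs)) (cong (_+_ (+ x)) (+-sumℕ xs))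

  +-divSumℕ : ∀ l f → + divSumℕ l f ≡ divSumℤ l (λ d k → + f d k)
  +-divSumℕ l f = begin
    + divSumℕ l f                    ≡⟨ +-sumℕ (concat terms) ⟩
    sumℤ (map (λ n → + n) (concat terms))     ≡⟨ cong sumℤ (List.concat-map terms) ⟨
    sumℤ (concat (map (map (λ n → + n)) terms)) ≡⟨ cong (sumℤ ∘ concat) (trans (sym (List.map-∘ (range1 l)))
                                           (List.map-cong (λ d → trans (sym (List.map-∘ (range1 l))) (List.map-cong (+-if d) (range1 l))) (range1 l))) ⟩
    divSumℤ l (λ d k → + f d k)      ∎
    where
    terms = map (λ d → map (λ k → if does (d ℕ.* k ≟ l) then f d k else 0) (range1 l)) (range1 l)
    +-if : ∀ d k → + (if does (d ℕ.* k ≟ l) then f d k else 0) ≡ [ does (d ℕ.* k ≟ l) ]· (+ f d k)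
    +-if d k with does (d ℕ.* k ≟ l)
    ... | true  = refl
    ... | false = refl

  divSumℕ-cong : ∀ l {f g} → (∀ d k → f d k ≡ g d k) → divSumℕ l f ≡ divSumℕ l g
  divSumℕ-cong l f≗g = cong (sumℕ ∘ concat) (List.map-cong (λ d → List.map-cong (λ k →
    cong (λ x → if does (d ℕ.* k ≟ l) then x else 0) (f≗g d k)) (range1 l)) (range1 l))

  divisors-positive : ∀ {l} d k → 1 ≤ l → d ℕ.* k ≡ l → 1 ≤ d × 1 ≤ k
  divisors-positive {l} d k 1≤l dk≡l = positive (λ d≡0 → trans (cong (ℕ._* k) d≡0) refl)
                                     , positive (λ k≡0 → trans (cong (d ℕ.*_) k≡0) (ℕ.*-zeroʳ d))
    where
    positive : ∀ {x} → (x ≡ 0 → d ℕ.* k ≡ 0) → 1 ≤ x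
    positive dk≡0 = ℕ.n≢0⇒n>0 λ x≡0 → ℕ.<⇒≢ 1≤l (sym (trans (sym dk≡l) (dk≡0 x≡0)))

  ∈-range1-divisor : ∀ {l} d k → 1 ≤ l → d ℕ.* k ≡ l → d ∈ range1 l × k ∈ range1 l
  ∈-range1-divisor d k 1≤l dk≡l =
    ∈-range1⁺ 1≤d (subst (d ≤_) dk≡l (m≤m*n⁺ 1≤k)) , ∈-range1⁺ 1≤k (subst (k ≤_) dk≡l (n≤m*n⁺ 1≤d))
    where
    1≤d = proj₁ (divisors-positive d k 1≤l dk≡l)
    1≤k = proj₂ (divisors-positive d k 1≤l dk≡l)

  range1-distinct : ∀ l → AllPairs (λ i j → i ≢ j) (range1 l)
  range1-distinct l = AllPairs.map⁺ (AllPairs.applyUpTo⁺₁ (λ i → i) l (λ i<j _ e → ℕ.<⇒≢ i<j (ℕ.suc-injective e)))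

  module _ {A : Set} where

    divConcat : ℕ → (ℕ → ℕ → List A) → List A
    divConcat l F = concat (map (λ d → concat (map (λ k → if does (d ℕ.* k ≟ l) then F d k else []) (range1 l))) (range1 l))

    length-concat : ∀ (xss : List (List A)) → length (concat xss) ≡ sumℕ (map length xss)
    length-concat []         = refl
    length-concat (xs ∷ xss) = trans (List.length-++ xs) (cong (length xs ℕ.+_) (length-concat xss))

    length-divConcat : ∀ l F → length (divConcat l F) ≡ divSumℕ l (λ d k → length (F d k))
    length-divConcat l F = begin
      length (divConcat l F)
        ≡⟨ length-concat (map (λ d → concat (blocks d)) (range1 l)) ⟩
      sumℕ (map length (map (λ d → concat (blocks d)) (range1 l)))
        ≡⟨ cong sumℕ (trans (sym (List.map-∘ (range1 l))) (List.map-cong (λ d → length-concat (blocks d)) (range1 l))) ⟩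
      sumℕ (map (λ d → sumℕ (map length (blocks d))) (range1 l))
        ≡⟨ cong sumℕ (List.map-cong (λ d → cong sumℕ (trans (sym (List.map-∘ (range1 l))) (List.map-cong (length-if d) (range1 l)))) (range1 l)) ⟩
      sumℕ (map (λ d → sumℕ (lengths d)) (range1 l))
        ≡⟨ cong sumℕ (List.map-∘ (range1 l)) ⟩
      sumℕ (map sumℕ (map lengths (range1 l)))
        ≡⟨ sumℕ-concat (map lengths (range1 l)) ⟨
      divSumℕ l (λ d k → length (F d k)) ∎
      where
      blocks : ℕ → List (List A)
      blocks d = map (λ k → if does (d ℕ.* k ≟ l) then F d k else []) (range1 l)
      lengths : ℕ → List ℕ
      lengths d = map (λ k → if does (d ℕ.* k ≟ l) then length (F d k) else 0) (range1 l)
      length-if : ∀ d k → length (if does (d ℕ.* k ≟ l) then F d k else []) ≡ (if does (d ℕ.* k ≟ l) then length (F d k) else 0)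
      length-if d k with does (d ℕ.* k ≟ l)
      ... | true  = refl
      ... | false = refl
      sumℕ-concat : ∀ (nss : List (List ℕ)) → sumℕ (concat nss) ≡ sumℕ (map sumℕ nss)
      sumℕ-concat []         = refl
      sumℕ-concat (ns ∷ nss) = trans (ListAction.sum-++ ns (concat nss)) (cong (sumℕ ns ℕ.+_) (sumℕ-concat nss))

    module _ {_≈_ : A → A → Set} {l : ℕ} (1≤l : 1 ≤ l) where

      enum-divConcat : ∀ {Q : A → Set} (P : ℕ → ℕ → A → Set) (F : ℕ → ℕ → List A) →
        (∀ {d k} → d ℕ.* k ≡ l → EnumUpTo _≈_ (P d k) (F d k)) →
        (∀ {d k d′ k′ x y} → d ℕ.* k ≡ l → d′ ℕ.* k′ ≡ l → P d k x → P d′ k′ y → x ≈ y → d ≡ d′) →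
        (∀ {d k x} → d ℕ.* k ≡ l → P d k x → Q x) →
        (∀ x → Q x → ∃₂ λ d k → d ℕ.* k ≡ l × P d k x) →
        EnumUpTo _≈_ Q (divConcat l F)
      enum-divConcat {Q} P F enum separated inside covered =
        enum-concat {_∼_ = _≡_} {P = Q} {Pᵢ = Pᵈ} (λ d → concat (map (block d) (range1 l))) (range1-distinct l)
          (All.tabulate (λ _ → enum-over-k _)) separated′ (All.tabulate (λ _ (_ , dk≡l , px) → inside dk≡l px)) covered′
        where
        block : ℕ → ℕ → List A
        block d k = if does (d ℕ.* k ≟ l) then F d k else []
        Pᵈ : ℕ → A → Set
        Pᵈ d x = ∃ λ k → d ℕ.* k ≡ l × P d k x
        enum-over-k : ∀ d → EnumUpTo _≈_ (Pᵈ d) (concat (map (block d) (range1 l)))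
        enum-over-k d = enum-concat {_∼_ = _≡_} {P = Pᵈ d} {Pᵢ = λ k x → d ℕ.* k ≡ l × P d k x} (block d) (range1-distinct l)
          (All.tabulate (λ {k} _ → enum-if (d ℕ.* k ≟ l) (λ dk≡l → enum-⇔ (dk≡l ,_) proj₂ (enum dk≡l)) proj₁))
          (λ (dk≡l , _) (dk′≡l , _) _ → ℕ.*-cancelˡ-≡ _ _ d {{ℕ.>-nonZero (proj₁ (divisors-positive d _ 1≤l dk≡l))}} (trans dk≡l (sym dk′≡l)))
          (All.tabulate (λ _ → witness))
          (λ x (k , dk≡l , px) → lose {P = λ k → d ℕ.* k ≡ l × P d k x} (proj₂ (∈-range1-divisor d k 1≤l dk≡l)) (dk≡l , px))
          where
          witness : ∀ {k x} → d ℕ.* k ≡ l × P d k x → Pᵈ d x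
          witness {k} (dk≡l , px) = k , dk≡l , px
        separated′ : ∀ {d d′ x y} → Pᵈ d x → Pᵈ d′ y → x ≈ y → d ≡ d′
        separated′ (_ , dk≡l , px) (_ , d′k′≡l , py) x≈y = separated dk≡l d′k′≡l px py x≈y
        covered′ : ∀ x → Q x → Any (λ d → Pᵈ d x) (range1 l)
        covered′ x qx with covered x qx
        ... | d , k , dk≡l , px = lose {P = λ d → Pᵈ d x} (proj₁ (∈-range1-divisor d k 1≤l dk≡l)) (k , dk≡l , px)

  ∑-divides : ∀ n {p k} x → 1 ≤ p → 1 ≤ k → k ≤ n → ∑ (range1 n) (λ j → [ does (p ℕ.* j ≟ k) ]· x) ≡ [ does (p ∣? k) ]· x
  ∑-divides n {p} {k} x 1≤p 1≤k k≤n with p ∣? k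
  ... | no p∤k = trans (∑-cong (range1 n) (λ j → []·-no (p ℕ.* j ≟ k) (λ pj≡k → p∤k (divides j (trans (sym pj≡k) (ℕ.*-comm p j))))))
                       (∑-zero (range1 n))
  ... | yes (divides q k≡qp) = trans (∑-cong (range1 n) (λ j → []·-cong (p ℕ.* j ≟ k) (j ≟ q) j≡q j≡q⁻¹ (λ _ → refl)))
                                     (∑-point n (λ _ → x) 1≤q (λ n<q → ⊥-elim (ℕ.<⇒≱ n<q (ℕ.≤-trans q≤k k≤n))))
    where
    pq≡k = sym (trans k≡qp (ℕ.*-comm q p))
    j≡q : ∀ {j} → p ℕ.* j ≡ k → j ≡ q
    j≡q pj≡k = ℕ.*-cancelˡ-≡ _ _ p {{ℕ.>-nonZero 1≤p}} (trans pj≡k (sym pq≡k))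
    j≡q⁻¹ : ∀ {j} → j ≡ q → p ℕ.* j ≡ k
    j≡q⁻¹ refl = pq≡k
    q≤k : q ≤ k
    q≤k = subst (q ≤_) pq≡k (n≤m*n⁺ 1≤p)
    1≤q : 1 ≤ q
    1≤q = ℕ.n≢0⇒n>0 λ q≡0 → ℕ.<⇒≢ 1≤k (sym (trans (sym pq≡k) (trans (cong (p ℕ.*_) q≡0) (ℕ.*-zeroʳ p))))

  divSumℤ-divisors : ∀ {m} → 1 ≤ m → (f : ℕ → ℤ) → divSumℤ m (λ k _ → f k) ≡ ∑ (range1 m) (λ k → [ does (k ∣? m) ]· f k)
  divSumℤ-divisors {m} 1≤m f = trans (divSumℤ-∑ m _) (∑-cong-range m (λ {k} 1≤k _ → ∑-divides m (f k) 1≤k 1≤m ℕ.≤-refl))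

  ∑-multiples : ∀ n {p} (F : ℕ → ℤ) → 1 ≤ p → (∀ {k} → n < k → F k ≡ + 0) →
                ∑ (range1 n) (λ k → [ does (p ∣? k) ]· F k) ≡ ∑ (range1 n) (λ j → F (p ℕ.* j))
  ∑-multiples n {p} F 1≤p beyond = begin
    ∑ (range1 n) (λ k → [ does (p ∣? k) ]· F k)
      ≡⟨ ∑-cong-range n (λ {k} 1≤k k≤n → ∑-divides n (F k) 1≤p 1≤k k≤n) ⟨
    ∑ (range1 n) (λ k → ∑ (range1 n) (λ j → [ does (p ℕ.* j ≟ k) ]· F k))
      ≡⟨ ∑-swap (range1 n) (range1 n) _ ⟩
    ∑ (range1 n) (λ j → ∑ (range1 n) (λ k → [ does (p ℕ.* j ≟ k) ]· F k))
      ≡⟨ ∑-cong-range n (λ {j} 1≤j _ → substitute n F (1≤* 1≤p 1≤j) beyond) ⟩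
    ∑ (range1 n) (λ j → F (p ℕ.* j)) ∎

module Abelianization where

  open import Defs
  open CyclicWord using (pow; rot; Rotation)
  open DivisorSum using (sumℤ-++)
  open import Data.Fin using (Fin; zero; suc)
  open import Data.Integer as ℤ using (ℤ; +_; _+_; _*_; -_; _-_)
  import Data.Integer.Properties as ℤ
  open import Data.Integer.Solver using (module +-*-Solver)
  open import Data.List using ([]; _++_; map; drop; take)
  import Data.List.Properties as List
  open import Data.Nat as ℕ using (ℕ; zero; suc; _≤_)
  open import Data.Product using (_,_)
  open import Data.Sum using (inj₂)
  open import Function using (_∘_)
  open import Data.Vec using (Vec; lookup; tabulate)
  import Data.Vec.Properties as Vec
  open import Relation.Binary.PropositionalEquality hiding (isEquivalence)
  import Relation.Binary.PropositionalEquality as ≡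
  open import Relation.Binary.Structures using (IsEquivalence)

  open ≡-Reasoning
  open +-*-Solver

  module _ {n : ℕ} where

    lookup-ext : ∀ {A : Set} (u v : Vec A n) → (∀ i → lookup u i ≡ lookup v i) → u ≡ v
    lookup-ext u v same = trans (sym (Vec.tabulate∘lookup u)) (trans (Vec.tabulate-cong same) (Vec.tabulate∘lookup v))

    lookup-⊕ : ∀ (u v : ℤVec n) i → lookup (u ⊕ v) i ≡ lookup u i + lookup v i
    lookup-⊕ u v i = Vec.lookup-zipWith _+_ i u v

    lookup-⊝ : ∀ (u : ℤVec n) i → lookup (⊝ u) i ≡ - lookup u i
    lookup-⊝ u i = Vec.lookup-map i -_ u

    lookup-⊖ : ∀ (u v : ℤVec n) i → lookup (u ⊖ v) i ≡ lookup u i - lookup v i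
    lookup-⊖ u v i = trans (lookup-⊕ u (⊝ v) i) (cong (_+_ (lookup u i)) (lookup-⊝ v i))

    lookup-· : ∀ k (u : ℤVec n) i → lookup (k · u) i ≡ + k * lookup u i
    lookup-· k u i = Vec.lookup-map i (λ x → + k * x) u

    lookup-𝟘 : ∀ i → lookup (𝟘 {n}) i ≡ + 0
    lookup-𝟘 i = Vec.lookup-replicate i (+ 0)

    ⊕-comm : ∀ (u v : ℤVec n) → u ⊕ v ≡ v ⊕ u
    ⊕-comm u v = lookup-ext _ _ λ i → trans (lookup-⊕ u v i) (trans (ℤ.+-comm (lookup u i) (lookup v i)) (sym (lookup-⊕ v u i)))

    ·-· : ∀ k k′ (v : ℤVec n) → k · (k′ · v) ≡ (k ℕ.* k′) · v
    ·-· k k′ v = lookup-ext _ _ λ i → begin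
      lookup (k · (k′ · v)) i       ≡⟨ trans (lookup-· k (k′ · v) i) (cong (+ k *_) (lookup-· k′ v i)) ⟩
      + k * (+ k′ * lookup v i)     ≡⟨ ℤ.*-assoc (+ k) (+ k′) _ ⟨
      + k * + k′ * lookup v i       ≡⟨ cong (_* lookup v i) (ℤ.pos-* k k′) ⟨
      + (k ℕ.* k′) * lookup v i     ≡⟨ lookup-· (k ℕ.* k′) v i ⟨
      lookup ((k ℕ.* k′) · v) i     ∎

    1· : ∀ (v : ℤVec n) → 1 · v ≡ v
    1· v = lookup-ext _ _ λ i → trans (lookup-· 1 v i) (ℤ.*-identityˡ (lookup v i))

    0· : ∀ (v : ℤVec n) → 0 · v ≡ 𝟘
    0· v = lookup-ext _ _ λ i → trans (lookup-· 0 v i) (sym (lookup-𝟘 i))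

    suc· : ∀ k (v : ℤVec n) → suc k · v ≡ v ⊕ k · v
    suc· k v = lookup-ext _ _ λ i → begin
      lookup (suc k · v) i         ≡⟨ lookup-· (suc k) v i ⟩
      + suc k * lookup v i         ≡⟨ solve 2 (λ k x → (con (+ 1) :+ k) :* x := x :+ k :* x) refl (+ k) (lookup v i) ⟩
      lookup v i + + k * lookup v i ≡⟨ trans (lookup-⊕ v (k · v) i) (cong (_+_ (lookup v i)) (lookup-· k v i)) ⟨
      lookup (v ⊕ k · v) i         ∎

    ⊖-self : ∀ (v : ℤVec n) → v ⊖ v ≡ 𝟘
    ⊖-self v = lookup-ext _ _ λ i → trans (lookup-⊖ v v i) (trans (ℤ.+-inverseʳ (lookup v i)) (sym (lookup-𝟘 i)))

    ⊝-⊖ : ∀ (u v : ℤVec n) → ⊝ (u ⊖ v) ≡ v ⊖ u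
    ⊝-⊖ u v = lookup-ext _ _ λ i → begin
      lookup (⊝ (u ⊖ v)) i         ≡⟨ trans (lookup-⊝ (u ⊖ v) i) (cong -_ (lookup-⊖ u v i)) ⟩
      - (lookup u i - lookup v i)  ≡⟨ solve 2 (λ x y → :- (x :- y) := y :- x) refl (lookup u i) (lookup v i) ⟩
      lookup v i - lookup u i      ≡⟨ lookup-⊖ v u i ⟨
      lookup (v ⊖ u) i             ∎

    ⊖-⊕-⊖ : ∀ (u v w : ℤVec n) → (u ⊖ v) ⊕ (v ⊖ w) ≡ u ⊖ w
    ⊖-⊕-⊖ u v w = lookup-ext _ _ λ i → begin
      lookup ((u ⊖ v) ⊕ (v ⊖ w)) i                           ≡⟨ trans (lookup-⊕ (u ⊖ v) (v ⊖ w) i) (cong₂ _+_ (lookup-⊖ u v i) (lookup-⊖ v w i)) ⟩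
      lookup u i - lookup v i + (lookup v i - lookup w i)    ≡⟨ solve 3 (λ x y z → x :- y :+ (y :- z) := x :- z) refl (lookup u i) (lookup v i) (lookup w i) ⟩
      lookup u i - lookup w i                                ≡⟨ lookup-⊖ u w i ⟨
      lookup (u ⊖ w) i                                       ∎

    ·-⊖ : ∀ k (u v : ℤVec n) → k · u ⊖ k · v ≡ k · (u ⊖ v)
    ·-⊖ k u v = lookup-ext _ _ λ i → begin
      lookup (k · u ⊖ k · v) i                    ≡⟨ trans (lookup-⊖ (k · u) (k · v) i) (cong₂ _-_ (lookup-· k u i) (lookup-· k v i)) ⟩
      + k * lookup u i - + k * lookup v i         ≡⟨ solve 3 (λ c x y → c :* x :- c :* y := c :* (x :- y)) refl (+ k) (lookup u i) (lookup v i) ⟩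
      + k * (lookup u i - lookup v i)             ≡⟨ trans (lookup-· k (u ⊖ v) i) (cong (+ k *_) (lookup-⊖ u v i)) ⟨
      lookup (k · (u ⊖ v)) i                      ∎

  sumℤV-+ : ∀ {n} (f g : Fin n → ℤ) → sumℤV (tabulate (λ i → f i + g i)) ≡ sumℤV (tabulate f) + sumℤV (tabulate g)
  sumℤV-+ {zero}  f g = refl
  sumℤV-+ {suc n} f g = begin
    f zero + g zero + sumℤV (tabulate (λ i → f (suc i) + g (suc i)))
      ≡⟨ cong (_+_ (f zero + g zero)) (sumℤV-+ (f ∘ suc) (g ∘ suc)) ⟩
    f zero + g zero + (sumℤV (tabulate (f ∘ suc)) + sumℤV (tabulate (g ∘ suc)))
      ≡⟨ solve 4 (λ a b c d → a :+ b :+ (c :+ d) := a :+ c :+ (b :+ d)) refl (f zero) (g zero) _ _ ⟩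
    f zero + sumℤV (tabulate (f ∘ suc)) + (g zero + sumℤV (tabulate (g ∘ suc))) ∎

  sumℤV-* : ∀ {n} c (f : Fin n → ℤ) → sumℤV (tabulate (λ i → c * f i)) ≡ c * sumℤV (tabulate f)
  sumℤV-* {zero}  c f = sym (ℤ.*-zeroʳ c)
  sumℤV-* {suc n} c f = trans (cong (_+_ (c * f zero)) (sumℤV-* c (λ i → f (suc i)))) (sym (ℤ.*-distribˡ-+ c _ _))

  module _ (G : Graph) where
    open Graph G

    private
      ∂-pointwise : ∀ {u v w : ℤVec E} a b → (∀ i → lookup w i ≡ a * lookup u i + b * lookup v i) →
                    ∀ x → ∂ G w x ≡ a * ∂ G u x + b * ∂ G v x
      ∂-pointwise {u} {v} {w} a b w≡ x = begin
        sumℤV (tabulate (λ i → lookup w i * c i))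
          ≡⟨ cong sumℤV (Vec.tabulate-cong λ i → trans (cong (_* c i) (w≡ i))
               (solve 5 (λ a b y z c → (a :* y :+ b :* z) :* c := a :* (y :* c) :+ b :* (z :* c)) refl a b (lookup u i) (lookup v i) (c i))) ⟩
        sumℤV (tabulate (λ i → a * (lookup u i * c i) + b * (lookup v i * c i)))
          ≡⟨ trans (sumℤV-+ (λ i → a * (lookup u i * c i)) _) (cong₂ _+_ (sumℤV-* a (λ i → lookup u i * c i)) (sumℤV-* b (λ i → lookup v i * c i))) ⟩
        a * ∂ G u x + b * ∂ G v x ∎
        where
        c : Fin E → ℤ
        c i = δ G (tgt i) x - δ G (src i) x

    ∂-· : ∀ k (u : ℤVec E) x → ∂ G (k · u) x ≡ + k * ∂ G u x
    ∂-· k u x = trans (∂-pointwise {u} {u} {k · u} (+ k) (+ 0) (λ i → trans (lookup-· k u i) (sym (ℤ.+-identityʳ (+ k * lookup u i)))) x)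
                      (ℤ.+-identityʳ (+ k * ∂ G u x))

    ∂-⊖ : ∀ (u v : ℤVec E) x → ∂ G (u ⊖ v) x ≡ ∂ G u x - ∂ G v x
    ∂-⊖ u v x = begin
      ∂ G (u ⊖ v) x                              ≡⟨ ∂-pointwise {u} {v} {u ⊖ v} (+ 1) (ℤ.-[1+ 0 ]) (λ i → trans (lookup-⊖ u v i)
                                                       (cong₂ _+_ (sym (ℤ.*-identityˡ (lookup u i))) (sym (ℤ.-1*i≡-i (lookup v i))))) x ⟩
      + 1 * ∂ G u x + ℤ.-[1+ 0 ] * ∂ G v x        ≡⟨ cong₂ _+_ (ℤ.*-identityˡ (∂ G u x)) (ℤ.-1*i≡-i (∂ G v x)) ⟩
      ∂ G u x - ∂ G v x                          ∎

    H₁-⊖⁻ : ∀ {u v} → InH₁ G (u ⊖ v) → InH₁ G v → InH₁ G u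
    H₁-⊖⁻ {u} {v} u⊖v∈H₁ v∈H₁ x = begin
      ∂ G u x             ≡⟨ ℤ.+-identityʳ _ ⟨
      ∂ G u x - + 0       ≡⟨ cong (λ y → ∂ G u x - y) (v∈H₁ x) ⟨
      ∂ G u x - ∂ G v x   ≡⟨ ∂-⊖ u v x ⟨
      ∂ G (u ⊖ v) x       ≡⟨ u⊖v∈H₁ x ⟩
      + 0                 ∎

    H₁-root : ∀ {k β} → 1 ≤ k → InH₁ G (k · β) → InH₁ G β
    H₁-root {suc k} {β} _ kβ∈H₁ x with ℤ.i*j≡0⇒i≡0∨j≡0 (+ suc k) (trans (sym (∂-· (suc k) β x)) (kβ∈H₁ x))
    ... | inj₂ ∂β≡0 = ∂β≡0

    ab-++ : ∀ C D → ab G (C ++ D) ≡ ab G C ⊕ ab G D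
    ab-++ C D = lookup-ext _ _ λ i → begin
      lookup (ab G (C ++ D)) i                                   ≡⟨ Vec.lookup∘tabulate _ i ⟩
      sumℤ (map (coeff G i) (C ++ D))                            ≡⟨ cong sumℤ (List.map-++ (coeff G i) C D) ⟩
      sumℤ (map (coeff G i) C ++ map (coeff G i) D)              ≡⟨ sumℤ-++ (map (coeff G i) C) _ ⟩
      sumℤ (map (coeff G i) C) + sumℤ (map (coeff G i) D)        ≡⟨ cong₂ _+_ (Vec.lookup∘tabulate _ i) (Vec.lookup∘tabulate _ i) ⟨
      lookup (ab G C) i + lookup (ab G D) i                      ≡⟨ lookup-⊕ (ab G C) (ab G D) i ⟨
      lookup (ab G C ⊕ ab G D) i                                 ∎

    ab-rot : ∀ k C → ab G (rot k C) ≡ ab G C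
    ab-rot k C = begin
      ab G (drop k C ++ take k C)      ≡⟨ ab-++ (drop k C) (take k C) ⟩
      ab G (drop k C) ⊕ ab G (take k C) ≡⟨ ⊕-comm (ab G (drop k C)) _ ⟩
      ab G (take k C) ⊕ ab G (drop k C) ≡⟨ ab-++ (take k C) (drop k C) ⟨
      ab G (take k C ++ drop k C)      ≡⟨ cong (ab G) (List.take++drop≡id k C) ⟩
      ab G C                           ∎

    ab-rotation : ∀ {C D} → Rotation C D → ab G D ≡ ab G C
    ab-rotation {C} (k , refl) = ab-rot k C

    ab-pow : ∀ D k → ab G (pow D k) ≡ k · ab G D
    ab-pow D zero    = trans (lookup-ext (ab G []) 𝟘 (λ i → trans (Vec.lookup∘tabulate _ i) (sym (lookup-𝟘 i)))) (sym (0· (ab G D)))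
    ab-pow D (suc k) = trans (ab-++ D (pow D k)) (trans (cong (ab G D ⊕_) (ab-pow D k)) (sym (suc· k (ab G D))))

    -- Equality in H₁ or in Q_Λ, on representatives in ℤ^E. With root∈H₁ the abelianization of a
    -- circuit is never shown to be a cycle: it is a root of α, hence in H₁.
    record HomologyQuotient (α : ℤVec E) : Set₁ where
      infix 4 _∼_
      field
        _∼_           : ℤVec E → ℤVec E → Set
        isEquivalence : IsEquivalence _∼_
        ·-cong        : ∀ k {β γ} → β ∼ γ → k · β ∼ k · γ
        root∈H₁       : ∀ {k β} → 1 ≤ k → k · β ∼ α → InH₁ G β

    homology : ∀ {α} → InH₁ G α → HomologyQuotient α
    homology α∈H₁ = record
      { _∼_           = _≡_
      ; isEquivalence = ≡.isEquivalence
      ; ·-cong        = λ k → cong (k ·_)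
      ; root∈H₁       = λ {k} {β} 1≤k kβ≡α → H₁-root {k} {β} 1≤k (subst (InH₁ G) (sym kβ≡α) α∈H₁)
      }

    moduloSubgroup : ∀ {α Λ} → InH₁ G α → FiniteIndexSubgroup G Λ → HomologyQuotient α
    moduloSubgroup {α} {Λ} α∈H₁ Λ≤H₁ = record
      { _∼_           = λ β γ → _≡[_]_ G β Λ γ
      ; isEquivalence = record
        { refl  = λ {β} → subst Λ (sym (⊖-self β)) has-0
        ; sym   = λ {β} {γ} β∼γ → subst Λ (⊝-⊖ β γ) (closed- _ β∼γ)
        ; trans = λ {β} {γ} {δ} β∼γ γ∼δ → subst Λ (⊖-⊕-⊖ β γ δ) (closed+ _ _ β∼γ γ∼δ)
        }
      ; ·-cong        = λ k {β} {γ} β∼γ → subst Λ (sym (·-⊖ k β γ)) (Λ-· k β∼γ)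
      ; root∈H₁       = λ {k} {β} 1≤k kβ∼α → H₁-root {k} {β} 1≤k (H₁-⊖⁻ {k · β} {α} (⊆H₁ _ kβ∼α) α∈H₁)
      }
      where
      open FiniteIndexSubgroup Λ≤H₁
      Λ-· : ∀ k {β} → Λ β → Λ (k · β)
      Λ-· zero    {β} _   = subst Λ (sym (0· β)) has-0
      Λ-· (suc k) {β} β∈Λ = subst Λ (sym (suc· k β)) (closed+ _ _ β∈Λ (Λ-· k β∈Λ))

module Mobius where

  open import Defs using (μ; divSumℤ; range1)
  open DivisorSum
  open import Data.Bool using (true; false; not; if_then_else_)
  open import Data.Empty using (⊥-elim)
  open import Data.Integer as ℤ using (ℤ; +_; -[1+_]; _+_; _*_; -_; _◃_; sign)
  import Data.Integer.Properties as ℤ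
  open import Data.List using ([]; _∷_)
  open import Data.List.Relation.Unary.All using (_∷_)
  open import Data.Nat as ℕ using (ℕ; zero; suc; _≤_; _<_; z≤n; s≤s; _≟_)
  import Data.Nat.Properties as ℕ
  open import Data.Nat.Coprimality using (Coprime; coprime-divisor)
  open import Data.Nat.Divisibility
  open import Data.Nat.ListAction using (product)
  open import Data.Nat.Primality
  open import Data.Nat.Primality.Factorisation using (factorise)
  open import Data.Product using (∃; _×_; _,_; proj₂)
  open import Data.Sum using (inj₁; inj₂)
  open import Data.Sign as Sign using (Sign)
  open import Function using (_∘_; _⇔_; mk⇔; Equivalence)
  open import Relation.Binary.PropositionalEquality
  open import Relation.Nullary using (¬_; yes; no; does)

  open ≡-Reasoning

  μ-factor : ℕ → ℕ → ℤ
  μ-factor n q = if does (prime? q)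
                 then (if does ((q ℕ.* q) ∣? n) then + 0 else if does (q ∣? n) then -[1+ 0 ] else + 1)
                 else + 1

  -- Defs.μ n multiplies the local factors μ-factor n q for q = n, …, 1 by a helper local to μ
  -- that is not in scope. Abstracting suc q in the unfolding of μ (suc q) leaves the sign and
  -- the absolute value of that helper applied to two distinct variables, so unification names
  -- them sign-go and abs-go; μ-go is then the helper up to ◃-inverse.
  private
    mutual
      sign-go : ℕ → ℕ → Sign
      sign-go = _

      abs-go : ℕ → ℕ → ℕ
      abs-go = _

      unfold-μ : ∀ q → μ (suc q) ≡ (sign (μ-factor (suc q) (suc q)) Sign.* sign-go (suc q) q)
                                     ◃ (ℤ.∣ μ-factor (suc q) (suc q) ∣ ℕ.* abs-go (suc q) q)
      unfold-μ q with suc q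
      ... | n = refl

  μ-go : ℕ → ℕ → ℤ
  μ-go n q = sign-go n q ◃ abs-go n q

  μ≡μ-go : ∀ n → μ n ≡ μ-go n n
  μ≡μ-go n = sym (ℤ.◃-inverse (μ n))

  μ-go-suc : ∀ n q → μ-go n (suc q) ≡ μ-factor n (suc q) * μ-go n q
  μ-go-suc n q = begin
    μ-go n (suc q)                                                ≡⟨ ℤ.◃-inverse ((sign F Sign.* sign-go n q) ◃ (ℤ.∣ F ∣ ℕ.* abs-go n q)) ⟩
    (sign F Sign.* sign-go n q) ◃ (ℤ.∣ F ∣ ℕ.* abs-go n q)          ≡⟨ ℤ.◃-distrib-* (sign F) (sign-go n q) ℤ.∣ F ∣ (abs-go n q) ⟩
    (sign F ◃ ℤ.∣ F ∣) * μ-go n q                                   ≡⟨ cong (_* μ-go n q) (ℤ.◃-inverse F) ⟩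
    F * μ-go n q                                                  ∎
    where F = μ-factor n (suc q)

  μ-factor-square : ∀ {n q} → Prime q → q ℕ.* q ∣ n → μ-factor n q ≡ + 0
  μ-factor-square {n} {q} pq qq∣n with prime? q
  ... | no ¬pq = ⊥-elim (¬pq pq)
  ... | yes _ with (q ℕ.* q) ∣? n
  ...   | yes _    = refl
  ...   | no ¬qq∣n = ⊥-elim (¬qq∣n qq∣n)

  μ-factor-∤ : ∀ {n q} → ¬ q ∣ n → μ-factor n q ≡ + 1
  μ-factor-∤ {n} {q} q∤n with prime? q
  ... | no _ = refl
  ... | yes _ with (q ℕ.* q) ∣? n
  ...   | yes qq∣n = ⊥-elim (q∤n (m*n∣⇒m∣ q q qq∣n))
  ...   | no _ with q ∣? n
  ...     | yes q∣n = ⊥-elim (q∤n q∣n)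
  ...     | no _    = refl

  μ-factor-prime-* : ∀ {p j} → Prime p → ¬ p ∣ j → μ-factor (p ℕ.* j) p ≡ -[1+ 0 ]
  μ-factor-prime-* {p} {j} pp p∤j with prime? p
  ... | no ¬pp = ⊥-elim (¬pp pp)
  ... | yes _ with (p ℕ.* p) ∣? (p ℕ.* j)
  ...   | yes pp∣pj = ⊥-elim (p∤j (*-cancelˡ-∣ p {{prime⇒nonZero pp}} pp∣pj))
  ...   | no _ with p ∣? (p ℕ.* j)
  ...     | yes _    = refl
  ...     | no ¬p∣pj = ⊥-elim (¬p∣pj (m∣m*n j))

  μ-factor-cong : ∀ {n n′ q} → (Prime q → (q ℕ.* q ∣ n ⇔ q ℕ.* q ∣ n′) × (q ∣ n ⇔ q ∣ n′)) → μ-factor n q ≡ μ-factor n′ q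
  μ-factor-cong {n} {n′} {q} same with prime? q
  ... | no _ = refl
  ... | yes pq with same pq
  ...   | square , linear with (q ℕ.* q) ∣? n | (q ℕ.* q) ∣? n′
  ...     | yes _ | yes _ = refl
  ...     | yes a | no ¬b = ⊥-elim (¬b (Equivalence.to square a))
  ...     | no ¬a | yes b = ⊥-elim (¬a (Equivalence.from square b))
  ...     | no _  | no _ with q ∣? n | q ∣? n′
  ...       | yes _ | yes _ = refl
  ...       | no _  | no _  = refl
  ...       | yes a | no ¬b = ⊥-elim (¬b (Equivalence.to linear a))
  ...       | no ¬a | yes b = ⊥-elim (¬a (Equivalence.from linear b))

  prime∣prime⇒≡ : ∀ {p q} → Prime p → Prime q → p ∣ q → p ≡ q
  prime∣prime⇒≡ pp pq p∣q with prime⇒irreducible pq p∣q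
  ... | inj₁ refl = ⊥-elim (¬prime[1] pp)
  ... | inj₂ p≡q  = p≡q

  module _ {p j} (pp : Prime p) (p∤j : ¬ p ∣ j) where

    private
      other-prime : ∀ {q} → Prime q → q ≢ p → q ∣ p ℕ.* j → q ∣ j
      other-prime pq q≢p q∣pj with euclidsLemma p j pq q∣pj
      ... | inj₁ q∣p = ⊥-elim (q≢p (prime∣prime⇒≡ pq pp q∣p))
      ... | inj₂ q∣j = q∣j

      coprime-square : ∀ {q} → Prime q → q ≢ p → Coprime (q ℕ.* q) p
      coprime-square {q} pq q≢p (d∣qq , d∣p) with prime⇒irreducible pp d∣p
      ... | inj₁ d≡1 = d≡1
      ... | inj₂ refl with euclidsLemma q q pp d∣qq
      ...   | inj₁ p∣q = ⊥-elim (q≢p (sym (prime∣prime⇒≡ pp pq p∣q)))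
      ...   | inj₂ p∣q = ⊥-elim (q≢p (sym (prime∣prime⇒≡ pp pq p∣q)))

    μ-factor-other : ∀ {q} → q ≢ p → μ-factor (p ℕ.* j) q ≡ μ-factor j q
    μ-factor-other q≢p = μ-factor-cong λ pq →
      mk⇔ (coprime-divisor (coprime-square pq q≢p)) (∣n⇒∣m*n p) , mk⇔ (other-prime pq q≢p) (∣n⇒∣m*n p)

    μ-go-below : ∀ N → N < p → μ-go (p ℕ.* j) N ≡ μ-go j N
    μ-go-below zero    _   = refl
    μ-go-below (suc N) N<p = begin
      μ-go (p ℕ.* j) (suc N)                        ≡⟨ μ-go-suc (p ℕ.* j) N ⟩
      μ-factor (p ℕ.* j) (suc N) * μ-go (p ℕ.* j) N ≡⟨ cong₂ _*_ (μ-factor-other (ℕ.<⇒≢ N<p)) (μ-go-below N (ℕ.<-trans (ℕ.n<1+n N) N<p)) ⟩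
      μ-factor j (suc N) * μ-go j N                 ≡⟨ μ-go-suc j N ⟨
      μ-go j (suc N)                                ∎

    μ-go-above : ∀ N → p ≤ N → μ-go (p ℕ.* j) N ≡ - μ-go j N
    μ-go-above zero    p≤0 = ⊥-elim (ℕ.<⇒≱ (ℕ.nonTrivial⇒n>1 p {{prime⇒nonTrivial pp}}) (ℕ.≤-trans p≤0 z≤n))
    μ-go-above (suc N) p≤ with p ≟ suc N
    ... | yes p≡ = begin
      μ-go (p ℕ.* j) (suc N)                  ≡⟨ μ-go-suc (p ℕ.* j) N ⟩
      μ-factor (p ℕ.* j) (suc N) * μ-go (p ℕ.* j) N
        ≡⟨ cong₂ _*_ (trans (cong (μ-factor (p ℕ.* j)) (sym p≡)) (μ-factor-prime-* pp p∤j))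
                     (μ-go-below N (subst (N <_) (sym p≡) (ℕ.n<1+n N))) ⟩
      -[1+ 0 ] * μ-go j N                     ≡⟨ ℤ.-1*i≡-i _ ⟩
      - μ-go j N                              ≡⟨ cong -_ (ℤ.*-identityˡ _) ⟨
      - (+ 1 * μ-go j N)                      ≡⟨ cong (λ x → - (x * μ-go j N)) (trans (sym (μ-factor-∤ p∤j)) (cong (μ-factor j) p≡)) ⟩
      - (μ-factor j (suc N) * μ-go j N)       ≡⟨ cong -_ (μ-go-suc j N) ⟨
      - μ-go j (suc N)                        ∎
    ... | no p≢ = begin
      μ-go (p ℕ.* j) (suc N)                   ≡⟨ μ-go-suc (p ℕ.* j) N ⟩
      μ-factor (p ℕ.* j) (suc N) * μ-go (p ℕ.* j) N
        ≡⟨ cong₂ _*_ (μ-factor-other (p≢ ∘ sym)) (μ-go-above N (ℕ.≤-pred (ℕ.≤∧≢⇒< p≤ p≢))) ⟩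
      μ-factor j (suc N) * - μ-go j N          ≡⟨ ℤ.neg-distribʳ-* (μ-factor j (suc N)) (μ-go j N) ⟨
      - (μ-factor j (suc N) * μ-go j N)        ≡⟨ cong -_ (μ-go-suc j N) ⟨
      - μ-go j (suc N)                         ∎

  μ-go-zero : ∀ {n q} N → μ-factor n q ≡ + 0 → 1 ≤ q → q ≤ N → μ-go n N ≡ + 0
  μ-go-zero         zero    _    1≤q q≤0 = ⊥-elim (ℕ.<⇒≱ 1≤q q≤0)
  μ-go-zero {n} {q} (suc N) f≡0 1≤q q≤ with q ≟ suc N
  ... | yes refl = trans (μ-go-suc n N) (cong (_* μ-go n N) f≡0)
  ... | no  q≢  = trans (μ-go-suc n N) (trans (cong (μ-factor n (suc N) *_) (μ-go-zero N f≡0 1≤q (ℕ.≤-pred (ℕ.≤∧≢⇒< q≤ q≢)))) (ℤ.*-zeroʳ (μ-factor n (suc N))))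

  μ-go-ones : ∀ {n} N M → N ≤ M → (∀ {q} → N < q → q ≤ M → μ-factor n q ≡ + 1) → μ-go n M ≡ μ-go n N
  μ-go-ones     N zero    N≤0 _ with z≤n ← N≤0 = refl
  μ-go-ones {n} N (suc M) N≤ ones with N ≟ suc M
  ... | yes refl = refl
  ... | no  N≢  = begin
    μ-go n (suc M)                ≡⟨ μ-go-suc n M ⟩
    μ-factor n (suc M) * μ-go n M ≡⟨ cong₂ _*_ (ones (s≤s N≤M) ℕ.≤-refl) (μ-go-ones N M N≤M (λ N<q q≤M → ones N<q (ℕ.m≤n⇒m≤1+n q≤M))) ⟩
    + 1 * μ-go n N                ≡⟨ ℤ.*-identityˡ _ ⟩
    μ-go n N                      ∎
    where
    N≤M : N ≤ M
    N≤M = ℕ.≤-pred (ℕ.≤∧≢⇒< N≤ N≢)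

  μ-go-stable : ∀ {n N} → 1 ≤ n → n ≤ N → μ-go n N ≡ μ n
  μ-go-stable {n} 1≤n n≤N = trans (μ-go-ones n _ n≤N λ n<q _ →
    μ-factor-∤ (λ q∣n → ℕ.<⇒≱ n<q (∣⇒≤ {{ℕ.>-nonZero 1≤n}} q∣n))) (sym (μ≡μ-go n))

  μ-square : ∀ {p n} → Prime p → p ℕ.* p ∣ n → 1 ≤ n → μ n ≡ + 0
  μ-square {p} {n} pp pp∣n 1≤n = trans (μ≡μ-go n) (μ-go-zero n (μ-factor-square pp pp∣n) (ℕ.n≢0⇒n>0 p≢0) (∣⇒≤ {{ℕ.>-nonZero 1≤n}} (m*n∣⇒m∣ p p pp∣n)))
    where p≢0 = ℕ.≢-nonZero⁻¹ p {{prime⇒nonZero pp}}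

  μ-prime-* : ∀ {p j} → Prime p → ¬ p ∣ j → 1 ≤ j → μ (p ℕ.* j) ≡ - μ j
  μ-prime-* {p} {j} pp p∤j 1≤j = begin
    μ (p ℕ.* j)              ≡⟨ μ≡μ-go (p ℕ.* j) ⟩
    μ-go (p ℕ.* j) (p ℕ.* j) ≡⟨ μ-go-above pp p∤j (p ℕ.* j) (ℕ.m≤m*n p j {{ℕ.>-nonZero 1≤j}}) ⟩
    - μ-go j (p ℕ.* j)       ≡⟨ cong -_ (μ-go-stable 1≤j (ℕ.m≤n*m j p {{prime⇒nonZero pp}})) ⟩
    - μ j                    ∎

  primeFactor : ∀ n → .{{_ : ℕ.NonZero n}} → n ≢ 1 → ∃ λ p → Prime p × p ∣ n
  primeFactor n n≢1 with factorise n
  ... | record { factors = [] ; isFactorisation = n≡1 } = ⊥-elim (n≢1 n≡1)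
  ... | record { factors = p ∷ ps ; isFactorisation = n≡ ; factorsPrime = pp ∷ _ } =
    p , pp , divides (product ps) (trans n≡ (ℕ.*-comm p (product ps)))

  private
    split : ∀ b x → x ≡ [ not b ]· x + [ b ]· x
    split true  x = sym (ℤ.+-identityˡ x)
    split false x = sym (ℤ.+-identityʳ x)

    []·-0 : ∀ b → [ b ]· (+ 0) ≡ + 0
    []·-0 true  = refl
    []·-0 false = refl

    lcm-prime : ∀ {p j m} → Prime p → ¬ p ∣ j → p ∣ m → j ∣ m → p ℕ.* j ∣ m
    lcm-prime {p} {j} pp p∤j p∣m (divides t m≡tj) with euclidsLemma t j pp (subst (p ∣_) m≡tj p∣m)
    ... | inj₂ p∣j = ⊥-elim (p∤j p∣j)
    ... | inj₁ (divides u t≡up) = divides u (trans m≡tj (trans (cong (ℕ._* j) t≡up) (ℕ.*-assoc u p j)))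

  ∑-μ-divisors : ∀ {m} → 1 ≤ m → ∑ (range1 m) (λ k → [ does (k ∣? m) ]· μ k) ≡ [ does (m ≟ 1) ]· (+ 1)
  ∑-μ-divisors {1}                _ = refl
  ∑-μ-divisors {m@(suc (suc m′))} _ with p , pp , p∣m ← primeFactor m (λ ())= begin
    ∑ R F                                                      ≡⟨ ∑-cong R (λ k → split (does (p ∣? k)) (F k)) ⟩
    ∑ R (λ k → [ not (does (p ∣? k)) ]· F k + [ does (p ∣? k) ]· F k) ≡⟨ ∑-+ R A _ ⟩
    ∑ R A + ∑ R (λ k → [ does (p ∣? k) ]· F k)                 ≡⟨ cong (_+_ (∑ R A)) (∑-multiples m F 1≤p beyond) ⟩
    ∑ R A + ∑ R (λ j → F (p ℕ.* j))                            ≡⟨ cong (_+_ (∑ R A)) (trans (∑-cong-range m (λ 1≤j _ → F[pj] 1≤j)) (∑-neg R A)) ⟩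
    ∑ R A + - ∑ R A                                            ≡⟨ ℤ.+-inverseʳ (∑ R A) ⟩
    + 0                                                        ∎
    where
    R = range1 m
    F : ℕ → ℤ
    F k = [ does (k ∣? m) ]· μ k
    A : ℕ → ℤ
    A k = [ not (does (p ∣? k)) ]· F k
    1≤p : 1 ≤ p
    1≤p = ℕ.n≢0⇒n>0 (ℕ.≢-nonZero⁻¹ p {{prime⇒nonZero pp}})
    beyond : ∀ {k} → m < k → F k ≡ + 0
    beyond m<k = []·-no (_ ∣? m) (λ k∣m → ℕ.<⇒≱ m<k (∣⇒≤ k∣m))
    F[pj] : ∀ {j} → 1 ≤ j → F (p ℕ.* j) ≡ - A j
    F[pj] {j} 1≤j with p ∣? j
    ... | yes p∣j = trans (cong ([ does (p ℕ.* j ∣? m) ]·_) (μ-square pp (*-monoʳ-∣ p p∣j) (ℕ.≤-trans 1≤j (ℕ.m≤n*m j p {{prime⇒nonZero pp}}))))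
                          ([]·-0 (does (p ℕ.* j ∣? m)))
    ... | no  p∤j = begin
      [ does (p ℕ.* j ∣? m) ]· μ (p ℕ.* j) ≡⟨ []·-cong (p ℕ.* j ∣? m) (j ∣? m) (∣-trans (n∣m*n p)) (lcm-prime pp p∤j p∣m) (λ _ → μ-prime-* pp p∤j 1≤j) ⟩
      [ does (j ∣? m) ]· (- μ j)           ≡⟨ []·-neg (does (j ∣? m)) (μ j) ⟨
      - F j                                ∎

  divSumℤ-μ : ∀ {m} → 1 ≤ m → divSumℤ m (λ k _ → μ k) ≡ [ does (m ≟ 1) ]· (+ 1)
  divSumℤ-μ 1≤m = trans (divSumℤ-divisors 1≤m μ) (∑-μ-divisors 1≤m)

  möbius-inversion : ∀ {l} → 1 ≤ l → (g : ℕ → ℕ → ℤ) →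
                     divSumℤ l (λ d k → μ k * divSumℤ d (λ d′ k′ → g d′ (k ℕ.* k′))) ≡ g l 1
  möbius-inversion {l} 1≤l g = begin
    divSumℤ l (λ d k → μ k * divSumℤ d (λ a b → g a (k ℕ.* b)))
      ≡⟨ divSumℤ-cong l (λ {d} {k} _ → divSumℤ-*ˡ d (μ k) _) ⟩
    divSumℤ l (λ d k → divSumℤ d (λ a b → μ k * g a (k ℕ.* b)))
      ≡⟨ divSumℤ-assoc l (λ a b k → μ k * g a (k ℕ.* b)) ⟩
    divSumℤ l (λ a m → divSumℤ m (λ k b → μ k * g a (k ℕ.* b)))
      ≡⟨ divSumℤ-cong l (λ {a} {m} _ → divSumℤ-cong m (λ {k} {b} kb≡m →
           trans (cong (λ x → μ k * g a x) kb≡m) (ℤ.*-comm (μ k) (g a m)))) ⟩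
    divSumℤ l (λ a m → divSumℤ m (λ k _ → g a m * μ k))
      ≡⟨ divSumℤ-cong l (λ {a} {m} _ → divSumℤ-*ˡ m (g a m) (λ k _ → μ k)) ⟨
    divSumℤ l (λ a m → g a m * divSumℤ m (λ k _ → μ k))
      ≡⟨ divSumℤ-cong l (λ {a} {m} am≡l → cong (g a m *_) (divSumℤ-μ (proj₂ (divisors-positive a m 1≤l am≡l)))) ⟩
    divSumℤ l (λ a m → g a m * [ does (m ≟ 1) ]· (+ 1))
      ≡⟨ divSumℤ-cong l (λ {a} {m} _ → trans ([]·-*ʳ (does (m ≟ 1)) (g a m) (+ 1)) (cong ([ does (m ≟ 1) ]·_) (ℤ.*-identityʳ (g a m)))) ⟩
    divSumℤ l (λ a m → [ does (m ≟ 1) ]· g a m)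
      ≡⟨ divSumℤ-point 1≤l g ⟩
    g l 1 ∎

module CircuitCount where

  open import Defs
  open CyclicWord
  open Circuit
  open Enumeration
  open DivisorSum
  open Abelianization
  open Mobius using (möbius-inversion)
  open import Data.Integer as ℤ using (+_)
  import Data.Integer.Properties as ℤ
  open import Data.List using (List; []; _∷_; length; map; concat; upTo)
  import Data.List.Properties as List
  open import Data.List.Relation.Unary.All as All using (All; []; _∷_)
  open import Data.List.Relation.Unary.Any as Any using (Any)
  open import Data.Nat as ℕ using (ℕ; zero; suc; _≤_; _<_)
  import Data.Nat.Properties as ℕ
  open import Data.Product using (∃; ∃₂; _×_; _,_; proj₁; proj₂)
  open import Function using (id)
  open import Relation.Binary.PropositionalEquality hiding (isEquivalence)
  import Relation.Binary.PropositionalEquality as ≡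
  open import Relation.Binary.Structures using (IsEquivalence)

  module _ (G : Graph) {α : ℤVec (Graph.E G)} (Q : HomologyQuotient G α) where
    open Graph G using (E)
    open HomologyQuotient Q
    open IsEquivalence isEquivalence using () renaming (refl to ∼-refl; sym to ∼-sym; trans to ∼-trans)

    private
      Walk : Set
      Walk = List (OEdge G)

    CircuitIn : ℤVec E → ℕ → Walk → Set
    CircuitIn β d C = IsCircuit G C × length C ≡ d × ab G C ∼ β

    PrimeCircuitIn : ℤVec E → ℕ → Walk → Set
    PrimeCircuitIn β d C = IsPrimeCircuit G C × length C ≡ d × ab G C ∼ β

    Root : ℕ → ℤVec E → Set
    Root k β = InH₁ G β × k · β ∼ α

    RootCircuit : ℕ → ℕ → Walk → Set
    RootCircuit K l C = IsCircuit G C × length C ≡ l × K · ab G C ∼ α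

    PrimePower : ℕ → ℕ → ℤVec E → Walk → Set
    PrimePower d k β x = ∃ λ D → PrimeCircuitIn β d D × x ≡ pow D k

    ·-ab-pow : ∀ K D k → K · ab G (pow D k) ≡ (K ℕ.* k) · ab G D
    ·-ab-pow K D k = trans (cong (K ·_) (ab-pow G D k)) (·-· K k (ab G D))

    module Classification
      (divs : ℕ → List (ℤVec E)) (enum-divs : ∀ k → 1 ≤ k → EnumUpTo _∼_ (Root k) (divs k))
      {_≈_ : Walk → Walk → Set} (≈⇒rotation : ∀ {x y} → x ≈ y → Rotation x y)
      (powers : ℕ → ℕ → ℤVec E → List Walk)
      (enum-powers : ∀ {d k} β → 1 ≤ k → EnumUpTo _≈_ (PrimePower d k β) (powers d k β))
      {K : ℕ} (1≤K : 1 ≤ K) where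

      RootPrimePower : ℕ → ℕ → Walk → Set
      RootPrimePower d k x = ∃ λ D → IsPrimeCircuit G D × length D ≡ d × (K ℕ.* k) · ab G D ∼ α × x ≡ pow D k

      blocks : ℕ → ℕ → List Walk
      blocks d k = concat (map (powers d k) (divs (K ℕ.* k)))

      private
        1≤K* : ∀ {k} → 1 ≤ k → 1 ≤ K ℕ.* k
        1≤K* {suc k} _ = ℕ.≤-trans 1≤K (ℕ.m≤m*n K (suc k))

        rotation-of-powers : ∀ {D D′ k k′} → 1 ≤ k → 1 ≤ k′ → IsPrimeCircuit G D → IsPrimeCircuit G D′ →
                             pow D k ≈ pow D′ k′ → Rotation D D′
        rotation-of-powers {k = suc k} {suc k′} _ _ pD pD′ x≈y =
          rotation-pow⁻ k k′ (primeCircuit⇒primitive G pD) (primeCircuit⇒primitive G pD′) (≈⇒rotation x≈y)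

      enum-rootPrimePower : ∀ {d k} → 1 ≤ k → EnumUpTo _≈_ (RootPrimePower d k) (blocks d k)
      enum-rootPrimePower {d} {k} 1≤k =
        enum-concat {_∼_ = _∼_} {P = RootPrimePower d k} {Pᵢ = PrimePower d k} (powers d k) (EnumUpTo.distinct roots)
          (All.tabulate (λ {β} _ → enum-powers β 1≤k)) separated (All.map inside (EnumUpTo.sound roots)) covered
        where
        roots = enum-divs (K ℕ.* k) (1≤K* 1≤k)
        separated : ∀ {β β′ x y} → PrimePower d k β x → PrimePower d k β′ y → x ≈ y → β ∼ β′
        separated {β′ = β′} (D , (pD , _ , D∼β) , refl) (D′ , (pD′ , _ , D′∼β′) , refl) x≈y =
          ∼-trans (∼-sym D∼β) (subst (_∼ β′) (ab-rotation G (rotation-of-powers 1≤k 1≤k pD pD′ x≈y)) D′∼β′)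
        inside : ∀ {β} → Root (K ℕ.* k) β → ∀ {x} → PrimePower d k β x → RootPrimePower d k x
        inside (_ , Kkβ∼α) (D , (pD , lD , D∼β) , x≡) = D , pD , lD , ∼-trans (·-cong (K ℕ.* k) D∼β) Kkβ∼α , x≡
        covered : ∀ x → RootPrimePower d k x → Any (λ β → PrimePower d k β x) (divs (K ℕ.* k))
        covered x (D , pD , lD , KkD∼α , x≡) =
          Any.map (λ D∼β → D , (pD , lD , D∼β) , x≡)
            (EnumUpTo.complete roots (ab G D) (root∈H₁ (1≤K* 1≤k) KkD∼α , KkD∼α))

      enum-rootCircuit : ∀ {l} → 1 ≤ l → EnumUpTo _≈_ (RootCircuit K l) (divConcat l blocks)
      enum-rootCircuit {l} 1≤l = enum-divConcat 1≤l RootPrimePower blocks (λ {d} dk≡l → enum-rootPrimePower (1≤k d dk≡l)) separated inside covered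
        where
        1≤k : ∀ d {k} → d ℕ.* k ≡ l → 1 ≤ k
        1≤k d {k} dk≡l = proj₂ (divisors-positive d k 1≤l dk≡l)
        separated : ∀ {d k d′ k′ x y} → d ℕ.* k ≡ l → d′ ℕ.* k′ ≡ l → RootPrimePower d k x → RootPrimePower d′ k′ y → x ≈ y → d ≡ d′
        separated {d} {k} {d′} {k′} dk≡l d′k′≡l (D , pD , refl , _ , refl) (D′ , pD′ , refl , _ , refl) x≈y =
          sym (proj₁ (rotation⇒shift (rotation-of-powers {k = k} {k′} (1≤k d dk≡l) (1≤k d′ d′k′≡l) pD pD′ x≈y)))
        inside : ∀ {d k x} → d ℕ.* k ≡ l → RootPrimePower d k x → RootCircuit K l x
        inside {d} {k = zero} dk≡l _ with () ← 1≤k d dk≡l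
        inside {k = suc k} dk≡l (D , pD , refl , KkD∼α , refl) =
          circuit-pow G k (proj₁ pD) ,
          trans (length-pow D (suc k)) (trans (ℕ.*-comm (suc k) (length D)) dk≡l) ,
          subst (_∼ α) (sym (·-ab-pow K D (suc k))) KkD∼α
        covered : ∀ x → RootCircuit K l x → ∃₂ λ d k → d ℕ.* k ≡ l × RootPrimePower d k x
        covered x (cx , lx , Kx∼α) with primeRoot G cx
        ... | D , k , pD , refl =
          length D , suc k , trans (ℕ.*-comm (length D) (suc k)) (trans (sym (length-pow D (suc k))) lx) ,
          D , pD , refl , subst (_∼ α) (·-ab-pow K D (suc k)) Kx∼α , refl

      length-blocks : ∀ d k → length (blocks d k) ≡ sumℕ (map (λ β → length (powers d k β)) (divs (K ℕ.* k)))
      length-blocks d k = trans (length-concat (map (powers d k) (divs (K ℕ.* k)))) (cong sumℕ (sym (List.map-∘ (divs (K ℕ.* k)))))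

      length-rootCircuit : ∀ l → length (divConcat l blocks) ≡ divSumℕ l (λ d k → sumℕ (map (λ β → length (powers d k β)) (divs (K ℕ.* k))))
      length-rootCircuit l = trans (length-divConcat l blocks) (divSumℕ-cong l length-blocks)

    module Formulas
      (divs : ℕ → List (ℤVec E)) (enum-divs : ∀ k → 1 ≤ k → EnumUpTo _∼_ (Root k) (divs k))
      (π : ℤVec E → ℕ → ℕ) (count-π : ∀ β d → Count Rotation (PrimeCircuitIn β d) (π β d)) where

      private
        primes : ℤVec E → ℕ → List Walk
        primes β d = proj₁ (count-π β d)

        enum-primes : ∀ β d → EnumUpTo Rotation (PrimeCircuitIn β d) (primes β d)
        enum-primes β d = proj₁ (proj₂ (count-π β d))

        length-primes : ∀ β d → length (primes β d) ≡ π β d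
        length-primes β d = proj₂ (proj₂ (count-π β d))

        prime⇒primitive : ∀ {D} → IsPrimeCircuit G D → Primitive D
        prime⇒primitive = primeCircuit⇒primitive G

      πDiv : ℕ → ℕ → ℕ
      πDiv d m = sumℕ (map (λ β → π β d) (divs m))

      cyclePowers : ℕ → ℕ → ℤVec E → List Walk
      cyclePowers d k β = map (λ D → pow D k) (primes β d)

      enum-cyclePowers : ∀ {d k} β → 1 ≤ k → EnumUpTo Rotation (PrimePower d k β) (cyclePowers d k β)
      enum-cyclePowers {d} {suc k} β _ = enum-map (λ D → pow D (suc k)) (enum-primes β d)
        (λ pD pD′ → rotation-pow⁻ k k (prime⇒primitive (proj₁ pD)) (prime⇒primitive (proj₁ pD′)))
        (λ {D} pD → D , pD , refl)
        (λ y (D , pD , y≡) → D , pD , λ _ D↻D′ → subst (λ w → Rotation w _) (sym y≡) (rotation-pow k D↻D′))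

      rotationsOf : ℕ → Walk → List Walk
      rotationsOf k D = map (λ i → pow (rot i D) k) (upTo (length D))

      RotatedPower : ℕ → Walk → Walk → Set
      RotatedPower k D x = IsPrimeCircuit G D × ∃ λ F → Rotation D F × x ≡ pow F k

      enum-rotationsOf : ∀ {k D} → IsPrimeCircuit G D → EnumUpTo _≡_ (RotatedPower (suc k) D) (rotationsOf (suc k) D)
      enum-rotationsOf {k} {D} pD = enum-upTo (λ i → pow (rot i D) (suc k)) (length D) injective
          (λ {i} _ → pD , rot i D , (i , refl) , refl) covered
        where
        primitive-rot : ∀ i → Primitive (rot i D)
        primitive-rot i = primitive-rotation (prime⇒primitive pD) (i , refl)
        injective : ∀ {i j} → i < length D → j < length D → pow (rot i D) (suc k) ≡ pow (rot j D) (suc k) → i ≡ j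
        injective {i} {j} i< j< eq = rot-injective (prime⇒primitive pD) i< j< (pow-injective k k (primitive-rot i) (primitive-rot j) eq)
        covered : ∀ x → RotatedPower (suc k) D x → ∃ λ i → i < length D × x ≡ pow (rot i D) (suc k)
        covered x (_ , F , D↻F , x≡) with rotation-index {{ℕ.>-nonZero (primitive⇒nonempty (prime⇒primitive pD))}} D↻F
        ... | i , i< , F≡ = i , i< , trans x≡ (cong (λ w → pow w (suc k)) F≡)

      circuitPowers : ℕ → ℕ → ℤVec E → List Walk
      circuitPowers d k β = concat (map (rotationsOf k) (primes β d))

      enum-circuitPowers : ∀ {d k} β → 1 ≤ k → EnumUpTo _≡_ (PrimePower d k β) (circuitPowers d k β)
      enum-circuitPowers {d} {suc k} β _ =
        enum-concat {_∼_ = Rotation} {P = PrimePower d (suc k) β} {Pᵢ = RotatedPower (suc k)} (rotationsOf (suc k))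
          (EnumUpTo.distinct (enum-primes β d)) (All.map (λ pD → enum-rotationsOf {k} (proj₁ pD)) (EnumUpTo.sound (enum-primes β d)))
          separated (All.map inside (EnumUpTo.sound (enum-primes β d))) covered
        where
        separated : ∀ {D D′ x y} → RotatedPower (suc k) D x → RotatedPower (suc k) D′ y → x ≡ y → Rotation D D′
        separated {D′ = D′} (pD , F , D↻F , refl) (pD′ , F′ , D′↻F′ , refl) eq =
          rotation-trans D↻F (subst (λ w → Rotation w D′) (sym F≡F′) (rotation-sym D′↻F′))
          where
          F≡F′ = pow-injective k k (prime⇒primitive (primeCircuit-rotation G D↻F pD)) (prime⇒primitive (primeCircuit-rotation G D′↻F′ pD′)) eq
        inside : ∀ {D} → PrimeCircuitIn β d D → ∀ {x} → RotatedPower (suc k) D x → PrimePower d (suc k) β x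
        inside (pD , lD , D∼β) (_ , F , D↻F , x≡) =
          F , (primeCircuit-rotation G D↻F pD , trans (proj₁ (rotation⇒shift D↻F)) lD , subst (_∼ β) (sym (ab-rotation G D↻F)) D∼β) , x≡
        covered : ∀ x → PrimePower d (suc k) β x → Any (λ D → RotatedPower (suc k) D x) (primes β d)
        covered x (F , pF , x≡) =
          Any.map (λ (pD , F↻D) → proj₁ pD , F , rotation-sym F↻D , x≡)
            (any-with-all (EnumUpTo.sound (enum-primes β d)) (EnumUpTo.complete (enum-primes β d) F pF))

      private
        sumℕ-*ˡ : ∀ {A : Set} d (f : A → ℕ) xs → sumℕ (map (λ x → d ℕ.* f x) xs) ≡ d ℕ.* sumℕ (map f xs)
        sumℕ-*ˡ d f []       = sym (ℕ.*-zeroʳ d)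
        sumℕ-*ˡ d f (x ∷ xs) = trans (cong (d ℕ.* f x ℕ.+_) (sumℕ-*ˡ d f xs)) (sym (ℕ.*-distribˡ-+ d (f x) _))

        sumℕ-constant : ∀ {A : Set} {f : A → ℕ} {d} xs → All (λ x → f x ≡ d) xs → sumℕ (map f xs) ≡ d ℕ.* length xs
        sumℕ-constant {d = d} []       []             = sym (ℕ.*-zeroʳ d)
        sumℕ-constant {d = d} (x ∷ xs) (fx≡d ∷ rest) = trans (cong₂ ℕ._+_ fx≡d (sumℕ-constant xs rest)) (sym (ℕ.*-suc d (length xs)))

      length-cyclePowers : ∀ d k β → length (cyclePowers d k β) ≡ π β d
      length-cyclePowers d k β = trans (List.length-map _ (primes β d)) (length-primes β d)

      length-circuitPowers : ∀ d k β → length (circuitPowers d k β) ≡ d ℕ.* π β d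
      length-circuitPowers d k β = begin
        length (concat (map (rotationsOf k) (primes β d)))           ≡⟨ length-concat (map (rotationsOf k) (primes β d)) ⟩
        sumℕ (map length (map (rotationsOf k) (primes β d)))         ≡⟨ cong sumℕ (List.map-∘ (primes β d)) ⟨
        sumℕ (map (λ D → length (rotationsOf k D)) (primes β d))     ≡⟨ sumℕ-constant (primes β d) (All.map length-rotationsOf (EnumUpTo.sound (enum-primes β d))) ⟩
        d ℕ.* length (primes β d)                                    ≡⟨ cong (d ℕ.*_) (length-primes β d) ⟩
        d ℕ.* π β d                                                  ∎
        where
        open ≡-Reasoning
        length-rotationsOf : ∀ {D} → PrimeCircuitIn β d D → length (rotationsOf k D) ≡ d
        length-rotationsOf {D} (_ , lD , _) = trans (List.length-map _ (upTo (length D))) (trans (List.length-upTo (length D)) lD)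

      count-rootCycles : ∀ {K l} → 1 ≤ K → 1 ≤ l → ∀ {xs} → EnumUpTo Rotation (RootCircuit K l) xs →
                         length xs ≡ divSumℕ l (λ d k → πDiv d (K ℕ.* k))
      count-rootCycles {K} {l} 1≤K 1≤l {xs} e = begin
        length xs
          ≡⟨ enum-length-unique rotation-isEquivalence e (C.enum-rootCircuit 1≤l) ⟩
        length (divConcat l C.blocks)
          ≡⟨ C.length-rootCircuit l ⟩
        divSumℕ l (λ d k → sumℕ (map (λ β → length (cyclePowers d k β)) (divs (K ℕ.* k))))
          ≡⟨ divSumℕ-cong l (λ d k → cong sumℕ (List.map-cong (length-cyclePowers d k) (divs (K ℕ.* k)))) ⟩
        divSumℕ l (λ d k → πDiv d (K ℕ.* k)) ∎
        where
        open ≡-Reasoning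
        module C = Classification divs enum-divs id cyclePowers enum-cyclePowers 1≤K

      count-rootCircuits : ∀ {K l} → 1 ≤ K → 1 ≤ l → ∀ {xs} → EnumUpTo _≡_ (RootCircuit K l) xs →
                           length xs ≡ divSumℕ l (λ d k → d ℕ.* πDiv d (K ℕ.* k))
      count-rootCircuits {K} {l} 1≤K 1≤l {xs} e = begin
        length xs
          ≡⟨ enum-length-unique ≡.isEquivalence e (C.enum-rootCircuit 1≤l) ⟩
        length (divConcat l C.blocks)
          ≡⟨ C.length-rootCircuit l ⟩
        divSumℕ l (λ d k → sumℕ (map (λ β → length (circuitPowers d k β)) (divs (K ℕ.* k))))
          ≡⟨ divSumℕ-cong l (λ d k → trans (cong sumℕ (List.map-cong (length-circuitPowers d k) (divs (K ℕ.* k))))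
                                           (sumℕ-*ˡ d (λ β → π β d) (divs (K ℕ.* k)))) ⟩
        divSumℕ l (λ d k → d ℕ.* πDiv d (K ℕ.* k)) ∎
        where
        open ≡-Reasoning
        module C = Classification divs enum-divs ≡⇒rotation circuitPowers enum-circuitPowers 1≤K

      private
        length-concat-map : ∀ (f : ℤVec E → List Walk) xs → length (concat (map f xs)) ≡ sumℕ (map (λ x → length (f x)) xs)
        length-concat-map f xs = trans (length-concat (map f xs)) (cong sumℕ (sym (List.map-∘ xs)))

        enum-⋃-roots : ∀ {k} → 1 ≤ k → {_≈_ : Walk → Walk → Set} → (∀ {x y} → x ≈ y → ab G y ≡ ab G x) →
                       {X : ℤVec E → Walk → Set} → (∀ {β C} → X β C → ab G C ∼ β) → (∀ {β β′ C} → β ∼ β′ → X β C → X β′ C) →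
                       (lists : ℤVec E → List Walk) → (∀ β → EnumUpTo _≈_ (X β) (lists β)) →
                       EnumUpTo _≈_ (λ C → ∃ λ β → Root k β × X β C) (concat (map lists (divs k)))
        enum-⋃-roots {k} 1≤k ab-resp {X} class reclass lists enum =
          enum-concat {_∼_ = _∼_} {Pᵢ = X} lists (EnumUpTo.distinct roots) (All.tabulate (λ {β} _ → enum β))
            (λ {_} {β′} x∈β y∈β′ x≈y → ∼-trans (∼-sym (class x∈β)) (subst (_∼ β′) (ab-resp x≈y) (class y∈β′)))
            (All.map (λ {β} root {C} x∈β → β , root , x∈β) (EnumUpTo.sound roots))
            (λ x (β , root , x∈β) → Any.map (λ β∼β′ → reclass β∼β′ x∈β) (EnumUpTo.complete roots β root))
          where roots = enum-divs k 1≤k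

        πDiv-1 : ∀ l → πDiv l 1 ≡ π α l
        πDiv-1 l = begin
          sumℕ (map (λ β → π β l) (divs 1))
            ≡⟨ cong sumℕ (List.map-cong (λ β → length-primes β l) (divs 1)) ⟨
          sumℕ (map (λ β → length (primes β l)) (divs 1))
            ≡⟨ length-concat-map (λ β → primes β l) (divs 1) ⟨
          length (concat (map (λ β → primes β l) (divs 1)))
            ≡⟨ enum-length-unique rotation-isEquivalence
                 (enum-⇔ united split (enum-⋃-roots ℕ.≤-refl (ab-rotation G) proj₂′ reclass (λ β → primes β l) (λ β → enum-primes β l)))
                 (enum-primes α l) ⟩
          length (primes α l)
            ≡⟨ length-primes α l ⟩
          π α l ∎
          where
          open ≡-Reasoning
          proj₂′ : ∀ {β C} → PrimeCircuitIn β l C → ab G C ∼ β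
          proj₂′ (_ , _ , C∼β) = C∼β
          reclass : ∀ {β β′ C} → β ∼ β′ → PrimeCircuitIn β l C → PrimeCircuitIn β′ l C
          reclass β∼β′ (pC , lC , C∼β) = pC , lC , ∼-trans C∼β β∼β′
          united : ∀ {C} → (∃ λ β → Root 1 β × PrimeCircuitIn β l C) → PrimeCircuitIn α l C
          united (β , (_ , 1β∼α) , pC , lC , C∼β) = pC , lC , ∼-trans C∼β (subst (_∼ α) (1· β) 1β∼α)
          split : ∀ {C} → PrimeCircuitIn α l C → ∃ λ β → Root 1 β × PrimeCircuitIn β l C
          split {C} (pC , lC , C∼α) = ab G C , (root∈H₁ ℕ.≤-refl 1C∼α , 1C∼α) , pC , lC , ∼-refl
            where 1C∼α = subst (_∼ α) (sym (1· (ab G C))) C∼α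

        sum-N-roots : ∀ {k d} → 1 ≤ k → 1 ≤ d → (N : ℤVec E → ℕ → ℕ) → (∀ β → Count _≡_ (CircuitIn β d) (N β d)) →
                      sumℕ (map (λ β → N β d) (divs k)) ≡ divSumℕ d (λ d′ k′ → d′ ℕ.* πDiv d′ (k ℕ.* k′))
        sum-N-roots {k} {d} 1≤k 1≤d N count-N = begin
          sumℕ (map (λ β → N β d) (divs k))
            ≡⟨ cong sumℕ (List.map-cong (λ β → proj₂ (proj₂ (count-N β))) (divs k)) ⟨
          sumℕ (map (λ β → length (circuits β)) (divs k))
            ≡⟨ length-concat-map circuits (divs k) ⟨
          length (concat (map circuits (divs k)))
            ≡⟨ count-rootCircuits 1≤k 1≤d
                 (enum-⇔ united split (enum-⋃-roots 1≤k (λ { refl → refl }) proj₂′ reclass circuits (λ β → proj₁ (proj₂ (count-N β))))) ⟩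
          divSumℕ d (λ d′ k′ → d′ ℕ.* πDiv d′ (k ℕ.* k′)) ∎
          where
          open ≡-Reasoning
          circuits : ℤVec E → List Walk
          circuits β = proj₁ (count-N β)
          proj₂′ : ∀ {β C} → CircuitIn β d C → ab G C ∼ β
          proj₂′ (_ , _ , C∼β) = C∼β
          reclass : ∀ {β β′ C} → β ∼ β′ → CircuitIn β d C → CircuitIn β′ d C
          reclass β∼β′ (c , lC , C∼β) = c , lC , ∼-trans C∼β β∼β′
          united : ∀ {C} → (∃ λ β → Root k β × CircuitIn β d C) → RootCircuit k d C
          united (β , (_ , kβ∼α) , c , lC , C∼β) = c , lC , ∼-trans (·-cong k C∼β) kβ∼α
          split : ∀ {C} → RootCircuit k d C → ∃ λ β → Root k β × CircuitIn β d C
          split {C} (c , lC , kC∼α) = ab G C , (root∈H₁ 1≤k kC∼α , kC∼α) , c , lC , ∼-refl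

        with-1· : ∀ l {C} → CircuitIn α l C → RootCircuit 1 l C
        with-1· l {C} (c , lC , C∼α) = c , lC , subst (_∼ α) (sym (1· (ab G C))) C∼α

        without-1· : ∀ l {C} → RootCircuit 1 l C → CircuitIn α l C
        without-1· l {C} (c , lC , 1C∼α) = c , lC , subst (_∼ α) (1· (ab G C)) 1C∼α

      cycle-formula : ∀ {l} → 1 ≤ l → ∀ {n} → Count Rotation (CircuitIn α l) n →
                      n ≡ divSumℕ l (λ d k → sumℕ (map (λ β → π β d) (divs k)))
      cycle-formula {l} 1≤l (xs , e , refl) =
        trans (count-rootCycles ℕ.≤-refl 1≤l (enum-⇔ (with-1· l) (without-1· l) e))
              (divSumℕ-cong l (λ d k → cong (πDiv d) (ℕ.*-identityˡ k)))

      circuit-formula : ∀ {l} → 1 ≤ l → ∀ {n} → Count _≡_ (CircuitIn α l) n →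
                        n ≡ divSumℕ l (λ d k → d ℕ.* sumℕ (map (λ β → π β d) (divs k)))
      circuit-formula {l} 1≤l (xs , e , refl) =
        trans (count-rootCircuits ℕ.≤-refl 1≤l (enum-⇔ (with-1· l) (without-1· l) e))
              (divSumℕ-cong l (λ d k → cong (λ m → d ℕ.* πDiv d m) (ℕ.*-identityˡ k)))

      prime-formula : ∀ {l} → 1 ≤ l → (N : ℤVec E → ℕ → ℕ) → (∀ β d → Count _≡_ (CircuitIn β d) (N β d)) →
                      + l ℤ.* + π α l ≡ divSumℤ l (λ d k → μ k ℤ.* + sumℕ (map (λ β → N β d) (divs k)))
      prime-formula {l} 1≤l N count-N = sym (begin
        divSumℤ l (λ d k → μ k ℤ.* + sumℕ (map (λ β → N β d) (divs k)))
          ≡⟨ divSumℤ-cong l (λ {d} {k} dk≡l → let (1≤d , 1≤k) = divisors-positive d k 1≤l dk≡l in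
               cong (λ n → μ k ℤ.* + n) (sum-N-roots 1≤k 1≤d N (λ β → count-N β d))) ⟩
        divSumℤ l (λ d k → μ k ℤ.* + divSumℕ d (λ d′ k′ → d′ ℕ.* πDiv d′ (k ℕ.* k′)))
          ≡⟨ divSumℤ-cong l (λ {d} {k} _ → cong (μ k ℤ.*_) (+-divSumℕ d (λ d′ k′ → d′ ℕ.* πDiv d′ (k ℕ.* k′)))) ⟩
        divSumℤ l (λ d k → μ k ℤ.* divSumℤ d (λ d′ k′ → + (d′ ℕ.* πDiv d′ (k ℕ.* k′))))
          ≡⟨ möbius-inversion 1≤l (λ d′ m → + (d′ ℕ.* πDiv d′ m)) ⟩
        + (l ℕ.* πDiv l 1)
          ≡⟨ cong (λ n → + (l ℕ.* n)) (πDiv-1 l) ⟩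
        + (l ℕ.* π α l)
          ≡⟨ ℤ.pos-* l (π α l) ⟩
        + l ℤ.* + π α l ∎)
        where open ≡-Reasoning


open import Defs
open Abelianization using (homology; moduloSubgroup)
open CircuitCount using (module Formulas)
open import Data.Nat using (ℕ; _≥_; _*_)
open import Data.Integer as ℤ using (ℤ; +_)
open import Data.List using (List; map)
open import Data.Product using (_×_; _,_)
open import Relation.Binary.PropositionalEquality using (_≡_)

proposition3p15 :
    (G : Graph) → Connected G →
    (Λ : ℤVec (Graph.E G) → Set) → FiniteIndexSubgroup G Λ →
    (α : ℤVec (Graph.E G)) → InH₁ G α →
    (l : ℕ) → l ≥ 1 →
    -- N(β,d), π(β,d), π_c(β,d)
    (N π πc : ℤVec (Graph.E G) → ℕ → ℕ) →
    (∀ β d → Count _≡_ (CircuitWith G β d) (N β d)) →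
    (∀ β d → Count (Rot G) (PrimeCircuitWith G β d) (π β d)) →
    (∀ β d → Count (Rot G) (CircuitWith G β d) (πc β d)) →
    -- N(β̲,d), π(β̲,d), π_c(β̲,d)  for β̲ = β + Λ
    (NQ πQ πcQ : ℤVec (Graph.E G) → ℕ → ℕ) →
    (∀ β d → Count _≡_ (CircuitWithQ G Λ β d) (NQ β d)) →
    (∀ β d → Count (Rot G) (PrimeCircuitWithQ G Λ β d) (πQ β d)) →
    (∀ β d → Count (Rot G) (CircuitWithQ G Λ β d) (πcQ β d)) →
    -- enumerations of [α ∣ k] ⊆ H₁ and of [α̲ ∣ k] ⊆ Q_Λ (by representatives)
    (divs : ℕ → List (ℤVec (Graph.E G))) →
    (∀ k → k ≥ 1 → EnumUpTo _≡_ (DivH G α k) (divs k)) →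
    (qdivs : ℕ → List (ℤVec (Graph.E G))) →
    (∀ k → k ≥ 1 → EnumUpTo (λ β γ → _≡[_]_ G β Λ γ) (DivQ G Λ α k) (qdivs k)) →
    -- (a)
    (πc α l ≡ divSumℕ l (λ d k → sumℕ (map (λ β → π β d) (divs k)))) ×
    -- (b)
    (πcQ α l ≡ divSumℕ l (λ d k → sumℕ (map (λ β → πQ β d) (qdivs k)))) ×
    -- (c)
    (N α l ≡ divSumℕ l (λ d k → d * sumℕ (map (λ β → π β d) (divs k)))) ×
    -- (d)
    (NQ α l ≡ divSumℕ l (λ d k → d * sumℕ (map (λ β → πQ β d) (qdivs k)))) ×
    -- (e)  (multiplied through by l)
    (+ l ℤ.* + π α l ≡ divSumℤ l (λ d k → μ k ℤ.* + sumℕ (map (λ β → N β d) (divs k)))) ×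
    -- (f)  (multiplied through by l)
    (+ l ℤ.* + πQ α l ≡ divSumℤ l (λ d k → μ k ℤ.* + sumℕ (map (λ β → NQ β d) (qdivs k))))
proposition3p15 G _ Λ Λ≤H₁ α α∈H₁ l 1≤l N π πc count-N count-π count-πc NQ πQ πcQ count-NQ count-πQ count-πcQ
                divs enum-divs qdivs enum-qdivs =
  H.cycle-formula 1≤l (count-πc α l) , Q.cycle-formula 1≤l (count-πcQ α l) ,
  H.circuit-formula 1≤l (count-N α l) , Q.circuit-formula 1≤l (count-NQ α l) ,
  H.prime-formula 1≤l N count-N , Q.prime-formula 1≤l NQ count-NQ
  where
  module H = Formulas G (homology G α∈H₁) divs enum-divs π count-π
  module Q = Formulas G (moduloSubgroup G α∈H₁ Λ≤H₁) qdivs enum-qdivs πQ count-πQ
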